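{- Let $m,n$ be positive integers and let $G=B_{m,n}$ be the jagged-rectangle benzenoid system. Then (1) $\prod_{u\in V(G)} d(u)^2 = 4^{2m+4n+2}\times 9^{4mn+2m-2n-4}$; (2) $\prod_{uv\in E(G)} d(u)d(v) = 4^{2n+4}\times 6^{4m+4n-4}\times 9^{6mn+m-5n-4}$; (3) $\prod_{v\in V(G)} d(v) = 2^{2m+4n+2}\times 3^{4mn+2m-2n-4}$; (4) $\prod_{uv\in E(G)}(d(u)+d(v)) = 4^{2n+4}\times 5^{4m+4n-4}\times 6^{6mn+m-5n-4}$; (5) $\prod_{uv\in E(G)}(d(u)+d(v))^2 = 4^{2(2n+4)}\times 5^{2(4m+4n-4)}\times 6^{2(6mn+m-5n-4)}$; (6) $\prod_{uv\in E(G)}(d(u)d(v))^2 = 4^{2(2n+4)}\times 6^{2(4m+4n-4)}\times 9^{2(6mn+m-5n-4)}$.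
   Context: For a graph $G$, $d(v)$ denotes the degree of vertex $v$. The jagged-rectangle benzenoid system $B_{m,n}$ is the graph (a subgraph of the hexagonal lattice, with hexagons drawn with two vertical sides) formed by $2n+1$ horizontal rows of hexagons stacked in the usual hexagonal-lattice fashion: rows $1,3,5,\dots,2n+1$ are linear chains of $m-1$ hexagons and rows $2,4,\dots,2n$ are linear chains of $m$ hexagons, the rows alternating starting and ending with a chain of $m-1$ hexagons; each chain of $m$ hexagons protrudes by half a hexagon beyond the adjacent chains of $m-1$ hexagons on both the left and right, and consecutive rows are glued along shared edges as in the hexagonal lattice. (For example, $B_{3,1}$ is coronene, with rows of $2,3,2$ hexagons.) -}

module Defs where

open import Data.Nat using (ℕ; zero; suc; _+_; _*_; _∸_; _^_; _≡ᵇ_; _≤ᵇ_)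
open import Data.Bool using (Bool; true; false; _∧_; _∨_; if_then_else_)
open import Data.Product using (_×_; _,_; proj₁; proj₂)
open import Data.List using (List; []; _∷_; map; filter; length; upTo; concatMap; _++_)
open import Data.Nat.ListAction using (product)
open import Data.Bool.ListAction using (any)
open import Relation.Nullary.Decidable using (Dec; yes; no)
open import Data.Bool.Properties using (T?)

-- Finite simple graphs given by an explicit list of vertices and an
-- explicit list of edges (each edge listed exactly once, as an
-- unordered pair written as an ordered pair of its endpoints).

record FinGraph (V : Set) : Set where
  field
    vertices : List V
    edges    : List (V × V)
    _≟ᵥ_     : V → V → Bool

open FinGraph public

deg : {V : Set} → FinGraph V → V → ℕ
deg G v = length (filter (λ e → T? (FinGraph._≟ᵥ_ G v (proj₁ e) ∨ FinGraph._≟ᵥ_ G v (proj₂ e))) (edges G))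

∏V : {V : Set} → FinGraph V → (V → ℕ) → ℕ
∏V G f = product (map f (vertices G))

∏E : {V : Set} → FinGraph V → (V → V → ℕ) → ℕ
∏E G f = product (map (λ e → f (proj₁ e) (proj₂ e)) (edges G))

-- The hexagonal lattice, drawn as a "brick wall" (hexagons with two
-- vertical sides).  The hexagon
-- with lower-left corner (x , y) has the six vertices
--   (x,y) (x+1,y) (x+2,y) (x,y+1) (x+1,y+1) (x+2,y+1)
-- and the six edges: two "vertical" sides (x,y)-(x,y+1), (x+2,y)-(x+2,y+1)
-- and the four slanted sides, drawn horizontally.
-- Neighbouring hexagons in a row: (x,y),(x+2,y) (share a vertical side);
-- the hexagons above (x,y) are (x-1,y+1) and (x+1,y+1) (half shift).

Point : Set
Point = ℕ × ℕ

_==ᵖ_ : Point → Point → Bool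
(a , b) ==ᵖ (c , d) = (a ≡ᵇ c) ∧ (b ≡ᵇ d)

_==ᵉ_ : Point × Point → Point × Point → Bool
(p , q) ==ᵉ (r , s) = (p ==ᵖ r) ∧ (q ==ᵖ s)

hexVertices : Point → List Point
hexVertices (x , y) =
  (x , y) ∷ (suc x , y) ∷ (2 + x , y) ∷
  (x , suc y) ∷ (suc x , suc y) ∷ (2 + x , suc y) ∷ []

hexEdges : Point → List (Point × Point)
hexEdges (x , y) =
  ((x , y) , (suc x , y)) ∷ ((suc x , y) , (2 + x , y)) ∷
  ((x , suc y) , (suc x , suc y)) ∷ ((suc x , suc y) , (2 + x , suc y)) ∷
  ((x , y) , (x , suc y)) ∷ ((2 + x , y) , (2 + x , suc y)) ∷ []

isEven : ℕ → Bool
isEven zero = true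
isEven (suc zero) = false
isEven (suc (suc k)) = isEven k

-- Rows with y even (rows 1,3,…,2n+1 of the paper) are chains of m-1
-- hexagons with lower-left corners x = 1,3,…,2m-3; rows with y odd
-- (rows 2,4,…,2n) are chains of m hexagons with x = 0,2,…,2m-2,
-- protruding half a hexagon on each side.

hexagonsB : ℕ → ℕ → List Point
hexagonsB m n = concatMap row (upTo (suc (2 * n)))
  where
  row : ℕ → List Point
  row y = if isEven y
          then map (λ k → (suc (2 * k) , y)) (upTo (m ∸ 1))
          else map (λ k → (2 * k , y)) (upTo m)

boxPoints : ℕ → ℕ → List Point
boxPoints m n = concatMap (λ x → map (λ y → (x , y)) (upTo (2 + 2 * n))) (upTo (suc (2 * m)))

boxEdges : ℕ → ℕ → List (Point × Point)
boxEdges m n = concatMap (λ p → (p , (suc (proj₁ p) , proj₂ p)) ∷ (p , (proj₁ p , suc (proj₂ p))) ∷ []) (boxPoints m n)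

B : ℕ → ℕ → FinGraph Point
B m n = record
  { vertices = filter (λ p → T? (any (λ h → any (p ==ᵖ_) (hexVertices h)) (hexagonsB m n))) (boxPoints m n)
  ; edges    = filter (λ e → T? (any (λ h → any (e ==ᵉ_) (hexEdges h)) (hexagonsB m n))) (boxEdges m n)
  ; _≟ᵥ_     = _==ᵖ_
  }

-- Lay B m n on the brick-wall lattice: its vertices are lattice points (x , y) with 0 ≤ x ≤ 2m and
-- 0 ≤ y ≤ 2n + 1, and a hexagon with lower-left corner (hx , hy) occurs iff hy ≤ 2n, hx + 2 ≤ 2m and
-- hx + hy is odd. Consequently the horizontal lattice edges of B m n are all those of the 2n middle
-- rows together with those starting at 1 ≤ x ≤ 2m − 2 in the two outer rows, and the vertical edge
-- above (x , y) is present exactly when y ≤ 2n and x + y is odd. So every vertex has degree 2 or 3,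
-- and along a row the degrees are 2-periodic except near the two ends. A degree-based product over
-- vertices or edges therefore factors, row by row, into monomials in the values on the degree classes
-- 2, 3 (vertices) or {2,2}, {2,3}, {3,3} (edges) with exponents linear in m, and the rows themselves
-- repeat with period 2 in y.

module Submission where

open import Defs
open import Data.Nat using (ℕ; _+_; _*_; _∸_; _^_; _≤_)
open import Data.Product using (_×_)
open import Relation.Binary.PropositionalEquality using (_≡_)

open import Algebra.Structures using (IsCommutativeMonoid)
open import Data.Bool using (Bool; true; false; T; not; _∧_; _∨_; _xor_; if_then_else_)
open import Data.Bool.ListAction using (any)
open import Data.Bool.Properties using (T?; T-∧; not-¬)
open import Data.Empty using (⊥; ⊥-elim)
open import Data.List using (List; []; _∷_; _++_; map; filter; length; concatMap; foldr; applyUpTo; upTo)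
open import Data.List.Membership.Propositional using (_∈_)
open import Data.List.Properties using (map-upTo; map-applyUpTo; map-++)
open import Data.List.Relation.Unary.Any as Any using (Any; here; there)
open import Data.List.Relation.Unary.Any.Properties using (any⁺; any⁻; concat⁺; concat⁻; map⁺; map⁻; applyUpTo⁺; applyUpTo⁻)
open import Data.Nat using (zero; suc; _<_; _≡ᵇ_; s≤s; z≤n)
open import Data.Nat.ListAction using (sum)
open import Data.Nat.Properties
open import Data.Nat.Tactic.RingSolver using (solve; solve-∀)
open import Data.Product using (_,_; proj₁; proj₂; ∃-syntax)
open import Data.Sum using (_⊎_; inj₁; inj₂)
open import Data.Unit using (tt)
open import Function using (_∘_; id; Equivalence)
open import Relation.Nullary using (¬_)
open import Relation.Binary.PropositionalEquality using (refl; sym; trans; cong; cong₂; subst; module ≡-Reasoning)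

-- Big operators over ℕ

module BigOperator {_∙_ : ℕ → ℕ → ℕ} {ε : ℕ} (isCommutativeMonoid : IsCommutativeMonoid _≡_ _∙_ ε) where

  open IsCommutativeMonoid isCommutativeMonoid using (assoc; comm; identityˡ; identityʳ)

  fold : List ℕ → ℕ
  fold = foldr _∙_ ε

  ⨁< : ℕ → (ℕ → ℕ) → ℕ
  ⨁< k f = fold (applyUpTo f k)

  interchange : ∀ a b c d → (a ∙ b) ∙ (c ∙ d) ≡ (a ∙ c) ∙ (b ∙ d)
  interchange a b c d = begin
    (a ∙ b) ∙ (c ∙ d)  ≡⟨ assoc a b (c ∙ d) ⟩
    a ∙ (b ∙ (c ∙ d))  ≡⟨ cong (a ∙_) (sym (assoc b c d)) ⟩
    a ∙ ((b ∙ c) ∙ d)  ≡⟨ cong (λ z → a ∙ (z ∙ d)) (comm b c) ⟩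
    a ∙ ((c ∙ b) ∙ d)  ≡⟨ cong (a ∙_) (assoc c b d) ⟩
    a ∙ (c ∙ (b ∙ d))  ≡⟨ sym (assoc a c (b ∙ d)) ⟩
    (a ∙ c) ∙ (b ∙ d)  ∎
    where open ≡-Reasoning

  fold-++ : ∀ xs ys → fold (xs ++ ys) ≡ fold xs ∙ fold ys
  fold-++ []       ys = sym (identityˡ (fold ys))
  fold-++ (x ∷ xs) ys = trans (cong (x ∙_) (fold-++ xs ys)) (sym (assoc x (fold xs) (fold ys)))

  fold-concatMap : ∀ {A B : Set} (f : B → ℕ) (g : A → List B) xs →
                   fold (map f (concatMap g xs)) ≡ fold (map (λ x → fold (map f (g x))) xs)
  fold-concatMap f g []       = refl
  fold-concatMap f g (x ∷ xs) = begin
    fold (map f (g x ++ concatMap g xs))                ≡⟨ cong fold (map-++ f (g x) _) ⟩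
    fold (map f (g x) ++ map f (concatMap g xs))        ≡⟨ fold-++ (map f (g x)) _ ⟩
    fold (map f (g x)) ∙ fold (map f (concatMap g xs))  ≡⟨ cong (_ ∙_) (fold-concatMap f g xs) ⟩
    fold (map f (g x)) ∙ fold (map (λ x → fold (map f (g x))) xs) ∎
    where open ≡-Reasoning

  fold-filter : ∀ {A : Set} (p : A → Bool) (f : A → ℕ) xs →
                fold (map f (filter (T? ∘ p) xs)) ≡ fold (map (λ x → if p x then f x else ε) xs)
  fold-filter p f []       = refl
  fold-filter p f (x ∷ xs) with p x
  ... | true  = cong (f x ∙_) (fold-filter p f xs)
  ... | false = trans (fold-filter p f xs) (sym (identityˡ _))

  ⨁-cong : ∀ {f g : ℕ → ℕ} k → (∀ i → i < k → f i ≡ g i) → ⨁< k f ≡ ⨁< k g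
  ⨁-cong zero    eq = refl
  ⨁-cong (suc k) eq = cong₂ _∙_ (eq 0 (s≤s z≤n)) (⨁-cong k (λ i i<k → eq (suc i) (s≤s i<k)))

  ⨁-ε : ∀ k → ⨁< k (λ _ → ε) ≡ ε
  ⨁-ε zero    = refl
  ⨁-ε (suc k) = trans (identityˡ _) (⨁-ε k)

  ⨁-distrib : ∀ (f g : ℕ → ℕ) k → ⨁< k (λ i → f i ∙ g i) ≡ ⨁< k f ∙ ⨁< k g
  ⨁-distrib f g zero    = sym (identityˡ ε)
  ⨁-distrib f g (suc k) = trans (cong (_ ∙_) (⨁-distrib (f ∘ suc) (g ∘ suc) k)) (interchange _ _ _ _)

  ⨁²-distrib : ∀ (f g : ℕ → ℕ → ℕ) k l →
               ⨁< k (λ x → ⨁< l (λ y → f x y ∙ g x y)) ≡ ⨁< k (λ x → ⨁< l (f x)) ∙ ⨁< k (λ x → ⨁< l (g x))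
  ⨁²-distrib f g k l = trans (⨁-cong k (λ x _ → ⨁-distrib (f x) (g x) l)) (⨁-distrib _ _ k)

  ⨁-swap : ∀ (f : ℕ → ℕ → ℕ) j k → ⨁< j (λ x → ⨁< k (f x)) ≡ ⨁< k (λ y → ⨁< j (λ x → f x y))
  ⨁-swap f zero    k = sym (⨁-ε k)
  ⨁-swap f (suc j) k = trans (cong (_ ∙_) (⨁-swap (f ∘ suc) j k)) (sym (⨁-distrib (f 0) _ k))

  ⨁-+ : ∀ (f : ℕ → ℕ) j k → ⨁< (j + k) f ≡ ⨁< j f ∙ ⨁< k (λ i → f (j + i))
  ⨁-+ f zero    k = sym (identityˡ _)
  ⨁-+ f (suc j) k = trans (cong (f 0 ∙_) (⨁-+ (f ∘ suc) j k)) (sym (assoc _ _ _))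

  ⨁-pairs : ∀ (f : ℕ → ℕ) k → ⨁< (2 * k) f ≡ ⨁< k (λ q → f (2 * q) ∙ f (1 + 2 * q))
  ⨁-pairs f zero    = refl
  ⨁-pairs f (suc k) = begin
    ⨁< (2 * suc k) f                                     ≡⟨ cong (λ l → ⨁< l f) (*-suc 2 k) ⟩
    f 0 ∙ (f 1 ∙ ⨁< (2 * k) (f ∘ suc ∘ suc))           ≡⟨ sym (assoc _ _ _) ⟩
    (f 0 ∙ f 1) ∙ ⨁< (2 * k) (f ∘ suc ∘ suc)           ≡⟨ cong (_ ∙_) (⨁-pairs (f ∘ suc ∘ suc) k) ⟩
    (f 0 ∙ f 1) ∙ ⨁< k (λ q → f (2 + 2 * q) ∙ f (3 + 2 * q))
      ≡⟨ cong (_ ∙_) (⨁-cong k (λ q _ → cong₂ (λ i j → f i ∙ f j) (sym (*-suc 2 q)) (cong suc (sym (*-suc 2 q))))) ⟩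
    ⨁< (suc k) (λ q → f (2 * q) ∙ f (1 + 2 * q))       ∎
    where open ≡-Reasoning

  ⨁-δ : ∀ (f : ℕ → ℕ) {i k} → i < k → ⨁< k (λ j → if i ≡ᵇ j then f j else ε) ≡ f i
  ⨁-δ f {zero}  {suc k} _         = trans (cong (f 0 ∙_) (⨁-ε k)) (identityʳ _)
  ⨁-δ f {suc i} {suc k} (s≤s i<k) = trans (identityˡ _) (⨁-δ (f ∘ suc) i<k)

  ⨁-δ² : ∀ (h : ℕ → ℕ → ℕ) {i j k l} → i < k → j < l →
         ⨁< k (λ x → ⨁< l (λ y → if i ≡ᵇ x then (if j ≡ᵇ y then h x y else ε) else ε)) ≡ h i j
  ⨁-δ² h {i} {j} {k} {l} i<k j<l = trans (⨁-cong k inner) (trans (⨁-δ _ i<k) (⨁-δ (h i) j<l))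
    where
    inner : ∀ x → x < k → ⨁< l (λ y → if i ≡ᵇ x then (if j ≡ᵇ y then h x y else ε) else ε) ≡
                          (if i ≡ᵇ x then ⨁< l (λ y → if j ≡ᵇ y then h x y else ε) else ε)
    inner x _ with i ≡ᵇ x
    ... | true  = refl
    ... | false = ⨁-ε l

  fold-grid : ∀ (f : ℕ × ℕ → ℕ) k l →
              fold (map f (concatMap (λ x → map (λ y → (x , y)) (upTo l)) (upTo k))) ≡
              ⨁< k (λ x → ⨁< l (λ y → f (x , y)))
  fold-grid f k l = begin
    fold (map f (concatMap (λ x → map (λ y → (x , y)) (upTo l)) (upTo k)))
      ≡⟨ fold-concatMap f (λ x → map (λ y → (x , y)) (upTo l)) (upTo k) ⟩
    fold (map (λ x → fold (map f (map (λ y → (x , y)) (upTo l)))) (upTo k))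
      ≡⟨ cong fold (map-upTo _ k) ⟩
    ⨁< k (λ x → fold (map f (map (λ y → (x , y)) (upTo l))))
      ≡⟨ ⨁-cong k (λ x _ → cong fold (trans (cong (map f) (map-upTo _ l)) (map-applyUpTo _ f l))) ⟩
    ⨁< k (λ x → ⨁< l (λ y → f (x , y))) ∎
    where open ≡-Reasoning

module ∏ = BigOperator *-1-isCommutativeMonoid
module ∑ = BigOperator +-0-isCommutativeMonoid

∏< ∑< : ℕ → (ℕ → ℕ) → ℕ
∏< = ∏.⨁<
∑< = ∑.⨁<

syntax ∏< k (λ i → e) = ∏[ i < k ] e
syntax ∑< k (λ i → e) = ∑[ i < k ] e

∏-const : ∀ c k → ∏[ _ < k ] c ≡ c ^ k
∏-const c zero    = refl
∏-const c (suc k) = cong (c *_) (∏-const c k)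

∏-split : ∀ (f : ℕ → ℕ) k t →
          ∏[ i < 2 + (2 * k + t) ] f i ≡
          f 0 * (f 1 * (∏[ j < t ] f (2 + 2 * k + j) * ∏[ q < k ] (f (2 + 2 * q) * f (3 + 2 * q))))
∏-split f k t = cong (λ z → f 0 * (f 1 * z)) (begin
  ∏[ i < 2 * k + t ] f (2 + i)
    ≡⟨ ∏.⨁-+ (f ∘ (2 +_)) (2 * k) t ⟩
  ∏[ i < 2 * k ] f (2 + i) * ∏[ j < t ] f (2 + 2 * k + j)
    ≡⟨ cong (_* ∏[ j < t ] f (2 + 2 * k + j)) (∏.⨁-pairs (f ∘ (2 +_)) k) ⟩
  ∏[ q < k ] (f (2 + 2 * q) * f (3 + 2 * q)) * ∏[ j < t ] f (2 + 2 * k + j)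
    ≡⟨ *-comm (∏[ q < k ] (f (2 + 2 * q) * f (3 + 2 * q))) _ ⟩
  ∏[ j < t ] f (2 + 2 * k + j) * ∏[ q < k ] (f (2 + 2 * q) * f (3 + 2 * q)) ∎)
  where open ≡-Reasoning

-- Monomials and 2-periodic products

module Monomial (u v w : ℕ) where

  data Exponent : Set where
    ⟨_,_,_⟩ : ℕ → ℕ → ℕ → Exponent

  infixr 5 _⊕_
  infix  6 _·_

  _⊕_ : Exponent → Exponent → Exponent
  ⟨ i , j , k ⟩ ⊕ ⟨ i′ , j′ , k′ ⟩ = ⟨ i + i′ , j + j′ , k + k′ ⟩

  _·_ : ℕ → Exponent → Exponent
  r · ⟨ i , j , k ⟩ = ⟨ r * i , r * j , r * k ⟩

  -- Opaque, so that the exponent of a factor ⟪ e ⟫ is recovered by unification.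
  opaque
    ⟪_⟫ : Exponent → ℕ
    ⟪ ⟨ i , j , k ⟩ ⟫ = u ^ i * v ^ j * w ^ k

  opaque
    unfolding ⟪_⟫

    ⟪⟫-def : ∀ i j k → ⟪ ⟨ i , j , k ⟩ ⟫ ≡ u ^ i * v ^ j * w ^ k
    ⟪⟫-def i j k = refl

    ⟪⟫-⊕ : ∀ e f → ⟪ e ⊕ f ⟫ ≡ ⟪ e ⟫ * ⟪ f ⟫
    ⟪⟫-⊕ ⟨ i , j , k ⟩ ⟨ i′ , j′ , k′ ⟩
      rewrite ^-distribˡ-+-* u i i′ | ^-distribˡ-+-* v j j′ | ^-distribˡ-+-* w k k′ =
        interchange (u ^ i) (v ^ j) (w ^ k) (u ^ i′) (v ^ j′) (w ^ k′)
      where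
      interchange : ∀ a b c a′ b′ c′ → a * a′ * (b * b′) * (c * c′) ≡ a * b * c * (a′ * b′ * c′)
      interchange = solve-∀

    ⟪0⟫ : ⟪ ⟨ 0 , 0 , 0 ⟩ ⟫ ≡ 1
    ⟪0⟫ = refl

    ⟪u⟫ : ⟪ ⟨ 1 , 0 , 0 ⟩ ⟫ ≡ u
    ⟪u⟫ = trans (*-identityʳ _) (trans (*-identityʳ _) (*-identityʳ u))

    ⟪v⟫ : ⟪ ⟨ 0 , 1 , 0 ⟩ ⟫ ≡ v
    ⟪v⟫ = trans (*-identityʳ _) (trans (+-identityʳ _) (*-identityʳ v))

    ⟪w⟫ : ⟪ ⟨ 0 , 0 , 1 ⟩ ⟫ ≡ w
    ⟪w⟫ = trans (+-identityʳ (w * 1)) (*-identityʳ w)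

  ⟪⟫-cong : ∀ {i j k i′ j′ k′} → i ≡ i′ → j ≡ j′ → k ≡ k′ → ⟪ ⟨ i , j , k ⟩ ⟫ ≡ ⟪ ⟨ i′ , j′ , k′ ⟩ ⟫
  ⟪⟫-cong refl refl refl = refl

  ⟪⟫-⊕-expand : ∀ e {f c} → ⟪ f ⟫ ≡ c → ⟪ e ⊕ f ⟫ ≡ ⟪ e ⟫ * c
  ⟪⟫-⊕-expand e {f} eq = trans (⟪⟫-⊕ e f) (cong (⟪ e ⟫ *_) eq)

  ⟪⟫-· : ∀ r e → ⟪ r · e ⟫ ≡ ⟪ e ⟫ ^ r
  ⟪⟫-· zero    ⟨ i , j , k ⟩ = ⟪0⟫
  ⟪⟫-· (suc r) ⟨ i , j , k ⟩ = ⟪⟫-⊕-expand ⟨ i , j , k ⟩ (⟪⟫-· r ⟨ i , j , k ⟩)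

  ∏-periodic : ∀ (f : ℕ → ℕ) k t {e₀ e₁ e p p′} →
               f 0 ≡ ⟪ e₀ ⟫ → f 1 ≡ ⟪ e₁ ⟫ → ∏[ j < t ] f (2 + 2 * k + j) ≡ ⟪ e ⟫ →
               (∀ q → q < k → f (2 + 2 * q) ≡ ⟪ p ⟫) → (∀ q → q < k → f (3 + 2 * q) ≡ ⟪ p′ ⟫) →
               ∏[ i < 2 + (2 * k + t) ] f i ≡ ⟪ e₀ ⊕ e₁ ⊕ e ⊕ k · (p ⊕ p′) ⟫
  ∏-periodic f k t {e₀} {e₁} {e} {p} {p′} f₀ f₁ tail evens odds = begin
    ∏[ i < 2 + (2 * k + t) ] f i
      ≡⟨ ∏-split f k t ⟩
    f 0 * (f 1 * (∏[ j < t ] f (2 + 2 * k + j) * ∏[ q < k ] (f (2 + 2 * q) * f (3 + 2 * q))))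
      ≡⟨ cong₂ _*_ f₀ (cong₂ _*_ f₁ (cong₂ _*_ tail (trans (∏.⨁-cong k periods) (∏-const ⟪ p ⊕ p′ ⟫ k)))) ⟩
    ⟪ e₀ ⟫ * (⟪ e₁ ⟫ * (⟪ e ⟫ * ⟪ p ⊕ p′ ⟫ ^ k))
      ≡⟨ sym (⟪⟫-⊕-expand e₀ (⟪⟫-⊕-expand e₁ (⟪⟫-⊕-expand e (⟪⟫-· k (p ⊕ p′))))) ⟩
    ⟪ e₀ ⊕ e₁ ⊕ e ⊕ k · (p ⊕ p′) ⟫ ∎
    where
    open ≡-Reasoning
    periods : ∀ q → q < k → f (2 + 2 * q) * f (3 + 2 * q) ≡ ⟪ p ⊕ p′ ⟫
    periods q q< = trans (cong₂ _*_ (evens q q<) (odds q q<)) (sym (⟪⟫-⊕ p p′))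

  ∏-row : ∀ (f : ℕ → ℕ) k {e₀ e₁ e₂ e₃ e₄ p p′} →
          f 0 ≡ ⟪ e₀ ⟫ → f 1 ≡ ⟪ e₁ ⟫ → f (2 + 2 * k) ≡ ⟪ e₂ ⟫ → f (3 + 2 * k) ≡ ⟪ e₃ ⟫ → f (4 + 2 * k) ≡ ⟪ e₄ ⟫ →
          (∀ q → q < k → f (2 + 2 * q) ≡ ⟪ p ⟫) → (∀ q → q < k → f (3 + 2 * q) ≡ ⟪ p′ ⟫) →
          ∏[ i < 5 + 2 * k ] f i ≡ ⟪ e₀ ⊕ e₁ ⊕ (e₂ ⊕ e₃ ⊕ e₄) ⊕ k · (p ⊕ p′) ⟫
  ∏-row f k {e₂ = e₂} {e₃} {e₄} f₀ f₁ f₂ f₃ f₄ evens odds =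
    trans (cong (λ l → ∏[ i < 2 + l ] f i) (+-comm 3 (2 * k))) (∏-periodic f k 3 f₀ f₁ tail evens odds)
    where
    tail : f (2 + 2 * k + 0) * (f (2 + 2 * k + 1) * (f (2 + 2 * k + 2) * 1)) ≡ ⟪ e₂ ⊕ e₃ ⊕ e₄ ⟫
    tail = trans (cong₂ _*_ (trans (cong f (+-identityʳ _)) f₂)
                            (cong₂ _*_ (trans (cong f (+-comm (2 + 2 * k) 1)) f₃)
                                       (trans (*-identityʳ _) (trans (cong f (+-comm (2 + 2 * k) 2)) f₄))))
                 (sym (⟪⟫-⊕-expand e₂ (⟪⟫-⊕ e₃ e₄)))

  ∏-column : ∀ (f : ℕ → ℕ) k {e₀ e₁ e₂ e₃ p p′} →
             f 0 ≡ ⟪ e₀ ⟫ → f 1 ≡ ⟪ e₁ ⟫ → f (2 + 2 * k) ≡ ⟪ e₂ ⟫ → f (3 + 2 * k) ≡ ⟪ e₃ ⟫ →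
             (∀ q → q < k → f (2 + 2 * q) ≡ ⟪ p ⟫) → (∀ q → q < k → f (3 + 2 * q) ≡ ⟪ p′ ⟫) →
             ∏[ i < 4 + 2 * k ] f i ≡ ⟪ e₀ ⊕ e₁ ⊕ (e₂ ⊕ e₃) ⊕ k · (p ⊕ p′) ⟫
  ∏-column f k {e₂ = e₂} {e₃} f₀ f₁ f₂ f₃ evens odds =
    trans (cong (λ l → ∏[ i < 2 + l ] f i) (+-comm 2 (2 * k))) (∏-periodic f k 2 f₀ f₁ tail evens odds)
    where
    tail : f (2 + 2 * k + 0) * (f (2 + 2 * k + 1) * 1) ≡ ⟪ e₂ ⊕ e₃ ⟫
    tail = trans (cong₂ _*_ (trans (cong f (+-identityʳ _)) f₂)
                            (trans (*-identityʳ _) (trans (cong f (+-comm (2 + 2 * k) 1)) f₃)))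
                 (sym (⟪⟫-⊕ e₂ e₃))

-- Subgraphs of the lattice

⟦_⟧ : Bool → ℕ
⟦ true  ⟧ = 1
⟦ false ⟧ = 0

⟦⟧-T : ∀ {b} → T b → ⟦ b ⟧ ≡ 1
⟦⟧-T {true} _ = refl

⟦⟧-¬T : ∀ {b} → ¬ T b → ⟦ b ⟧ ≡ 0
⟦⟧-¬T {true}  ¬t = ⊥-elim (¬t tt)
⟦⟧-¬T {false} _  = refl

if-T : ∀ {A : Set} {b} {x y : A} → T b → (if b then x else y) ≡ x
if-T {b = true} _ = refl

if-¬T : ∀ {A : Set} {b} {x y : A} → ¬ T b → (if b then x else y) ≡ y
if-¬T {b = true}  ¬t = ⊥-elim (¬t tt)
if-¬T {b = false} _  = refl

length-filter-sum : ∀ {A : Set} (p : A → Bool) xs → length (filter (T? ∘ p) xs) ≡ sum (map (⟦_⟧ ∘ p) xs)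
length-filter-sum p []       = refl
length-filter-sum p (x ∷ xs) with p x
... | true  = cong suc (length-filter-sum p xs)
... | false = length-filter-sum p xs

onlyIf : Bool → Bool → ℕ → ℕ
onlyIf a b c = if a then (if b then c else 0) else 0

onlyIf-false : ∀ a c → onlyIf a false c ≡ 0
onlyIf-false true  c = refl
onlyIf-false false c = refl

if-⟦∧⟧ : ∀ e c d → (if e then ⟦ c ∧ d ⟧ else 0) ≡ onlyIf c d ⟦ e ⟧
if-⟦∧⟧ true  true  true  = refl
if-⟦∧⟧ true  true  false = refl
if-⟦∧⟧ true  false d     = refl
if-⟦∧⟧ false true  true  = refl
if-⟦∧⟧ false true  false = refl
if-⟦∧⟧ false false d     = refl

if-⟦∨⟧ : ∀ e a b c d → (T a → T b → T c → T d → ⊥) →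
         (if e then ⟦ (a ∧ b) ∨ (c ∧ d) ⟧ else 0) ≡ onlyIf a b ⟦ e ⟧ + onlyIf c d ⟦ e ⟧
if-⟦∨⟧ e     false b     c     d     _         = if-⟦∧⟧ e c d
if-⟦∨⟧ e     true  false c     d     _         = if-⟦∧⟧ e c d
if-⟦∨⟧ true  true  true  true  true  exclusive = ⊥-elim (exclusive _ _ _ _)
if-⟦∨⟧ true  true  true  true  false _         = refl
if-⟦∨⟧ true  true  true  false d     _         = refl
if-⟦∨⟧ false true  true  true  true  _         = refl
if-⟦∨⟧ false true  true  true  false _         = refl
if-⟦∨⟧ false true  true  false d     _         = refl

horizontal vertical : ℕ → ℕ → Point × Point
horizontal x y = (x , y) , (suc x , y)
vertical   x y = (x , y) , (x , suc y)

latticeGraph : ℕ → ℕ → (Point → Bool) → (Point × Point → Bool) → FinGraph Point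
latticeGraph m n isVertex isEdge = record
  { vertices = filter (T? ∘ isVertex) (boxPoints m n)
  ; edges    = filter (T? ∘ isEdge) (boxEdges m n)
  ; _≟ᵥ_     = _==ᵖ_
  }

module LatticeGraph (m n : ℕ) (isVertex : Point → Bool) (isEdge : Point × Point → Bool) where

  G : FinGraph Point
  G = latticeGraph m n isVertex isEdge

  latticeEdges : Point → List (Point × Point)
  latticeEdges (x , y) = horizontal x y ∷ vertical x y ∷ []

  ∏V-lattice : ∀ (F : Point → ℕ) →
               ∏V G F ≡ ∏[ x < suc (2 * m) ] ∏[ y < 2 + 2 * n ] (if isVertex (x , y) then F (x , y) else 1)
  ∏V-lattice F = trans (∏.fold-filter isVertex F (boxPoints m n))
                       (∏.fold-grid (λ p → if isVertex p then F p else 1) (suc (2 * m)) (2 + 2 * n))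

  weight : (Point → Point → ℕ) → Point × Point → ℕ
  weight F e = if isEdge e then F (proj₁ e) (proj₂ e) else 1

  ∏E-lattice : ∀ (F : Point → Point → ℕ) →
               ∏E G F ≡ ∏[ x < suc (2 * m) ] ∏[ y < 2 + 2 * n ] (weight F (horizontal x y) * weight F (vertical x y))
  ∏E-lattice F = begin
    ∏E G F
      ≡⟨ ∏.fold-filter isEdge (λ e → F (proj₁ e) (proj₂ e)) (boxEdges m n) ⟩
    ∏.fold (map (weight F) (boxEdges m n))
      ≡⟨ ∏.fold-concatMap (weight F) latticeEdges (boxPoints m n) ⟩
    ∏.fold (map (λ p → ∏.fold (map (weight F) (latticeEdges p))) (boxPoints m n))
      ≡⟨ ∏.fold-grid (λ p → ∏.fold (map (weight F) (latticeEdges p))) (suc (2 * m)) (2 + 2 * n) ⟩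
    ∏[ x < suc (2 * m) ] ∏[ y < 2 + 2 * n ] (weight F (horizontal x y) * (weight F (vertical x y) * 1))
      ≡⟨ ∏.⨁-cong (suc (2 * m)) (λ x _ → ∏.⨁-cong (2 + 2 * n) (λ y _ →
           cong (weight F (horizontal x y) *_) (*-identityʳ (weight F (vertical x y))))) ⟩
    ∏[ x < suc (2 * m) ] ∏[ y < 2 + 2 * n ] (weight F (horizontal x y) * weight F (vertical x y)) ∎
    where open ≡-Reasoning

  westDegree southDegree horizontalDegree verticalDegree : ℕ → ℕ → ℕ
  westDegree zero    y = 0
  westDegree (suc x) y = ⟦ isEdge (horizontal x y) ⟧
  southDegree x zero    = 0
  southDegree x (suc y) = ⟦ isEdge (vertical x y) ⟧
  horizontalDegree x y = ⟦ isEdge (horizontal x y) ⟧ + westDegree x y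
  verticalDegree   x y = ⟦ isEdge (vertical x y) ⟧ + southDegree x y

  deg-lattice : ∀ {x y} → x < suc (2 * m) → y < 2 + 2 * n → deg G (x , y) ≡ horizontalDegree x y + verticalDegree x y
  deg-lattice {x} {y} x< y< = begin
    deg G (x , y)
      ≡⟨ length-filter-sum (incident (x , y)) (edges G) ⟩
    sum (map (⟦_⟧ ∘ incident (x , y)) (edges G))
      ≡⟨ ∑.fold-filter isEdge (⟦_⟧ ∘ incident (x , y)) (boxEdges m n) ⟩
    sum (map term (boxEdges m n))
      ≡⟨ ∑.fold-concatMap term latticeEdges (boxPoints m n) ⟩
    sum (map (λ p → sum (map term (latticeEdges p))) (boxPoints m n))
      ≡⟨ ∑.fold-grid (λ p → sum (map term (latticeEdges p))) (suc (2 * m)) (2 + 2 * n) ⟩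
    ∑[ x′ < suc (2 * m) ] ∑[ y′ < 2 + 2 * n ] (term (horizontal x′ y′) + (term (vertical x′ y′) + 0))
      ≡⟨ ∑.⨁-cong (suc (2 * m)) (λ x′ _ → ∑.⨁-cong (2 + 2 * n) (λ y′ _ → split x′ y′)) ⟩
    ∑[ x′ < suc (2 * m) ] ∑[ y′ < 2 + 2 * n ] ((here→ x′ y′ + west→ x′ y′) + (here↑ x′ y′ + south↑ x′ y′))
      ≡⟨ ∑.⨁²-distrib (λ x′ y′ → here→ x′ y′ + west→ x′ y′) (λ x′ y′ → here↑ x′ y′ + south↑ x′ y′) (suc (2 * m)) (2 + 2 * n) ⟩
    ∑[ x′ < suc (2 * m) ] ∑[ y′ < 2 + 2 * n ] (here→ x′ y′ + west→ x′ y′) +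
    ∑[ x′ < suc (2 * m) ] ∑[ y′ < 2 + 2 * n ] (here↑ x′ y′ + south↑ x′ y′)
      ≡⟨ cong₂ _+_ (∑.⨁²-distrib here→ west→ (suc (2 * m)) (2 + 2 * n)) (∑.⨁²-distrib here↑ south↑ (suc (2 * m)) (2 + 2 * n)) ⟩
    (∑[ x′ < suc (2 * m) ] ∑[ y′ < 2 + 2 * n ] here→ x′ y′ + ∑[ x′ < suc (2 * m) ] ∑[ y′ < 2 + 2 * n ] west→ x′ y′) +
    (∑[ x′ < suc (2 * m) ] ∑[ y′ < 2 + 2 * n ] here↑ x′ y′ + ∑[ x′ < suc (2 * m) ] ∑[ y′ < 2 + 2 * n ] south↑ x′ y′)
      ≡⟨ cong₂ _+_ (cong₂ _+_ (∑.⨁-δ² H x< y<) (west x x<)) (cong₂ _+_ (∑.⨁-δ² V x< y<) (south y y<)) ⟩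
    horizontalDegree x y + verticalDegree x y ∎
    where
    open ≡-Reasoning
    incident : Point → Point × Point → Bool
    incident v e = (v ==ᵖ proj₁ e) ∨ (v ==ᵖ proj₂ e)
    term : Point × Point → ℕ
    term e = if isEdge e then ⟦ incident (x , y) e ⟧ else 0
    H V : ℕ → ℕ → ℕ
    H x′ y′ = ⟦ isEdge (horizontal x′ y′) ⟧
    V x′ y′ = ⟦ isEdge (vertical x′ y′) ⟧
    here→ west→ here↑ south↑ : ℕ → ℕ → ℕ
    here→  x′ y′ = onlyIf (x ≡ᵇ x′) (y ≡ᵇ y′) (H x′ y′)
    west→  x′ y′ = onlyIf (x ≡ᵇ suc x′) (y ≡ᵇ y′) (H x′ y′)
    here↑  x′ y′ = onlyIf (x ≡ᵇ x′) (y ≡ᵇ y′) (V x′ y′)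
    south↑ x′ y′ = onlyIf (x ≡ᵇ x′) (y ≡ᵇ suc y′) (V x′ y′)
    split : ∀ x′ y′ → term (horizontal x′ y′) + (term (vertical x′ y′) + 0) ≡
            (here→ x′ y′ + west→ x′ y′) + (here↑ x′ y′ + south↑ x′ y′)
    split x′ y′ = cong₂ _+_
      (if-⟦∨⟧ (isEdge (horizontal x′ y′)) (x ≡ᵇ x′) (y ≡ᵇ y′) (x ≡ᵇ suc x′) (y ≡ᵇ y′)
              (λ p _ q _ → m≢1+n+m x′ {0} (trans (sym (≡ᵇ⇒≡ x x′ p)) (≡ᵇ⇒≡ x (suc x′) q))))
      (trans (+-identityʳ _)
             (if-⟦∨⟧ (isEdge (vertical x′ y′)) (x ≡ᵇ x′) (y ≡ᵇ y′) (x ≡ᵇ x′) (y ≡ᵇ suc y′)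
                     (λ _ p _ q → m≢1+n+m y′ {0} (trans (sym (≡ᵇ⇒≡ y y′ p)) (≡ᵇ⇒≡ y (suc y′) q)))))
    west : ∀ x → x < suc (2 * m) → ∑[ x′ < suc (2 * m) ] ∑[ y′ < 2 + 2 * n ] onlyIf (x ≡ᵇ suc x′) (y ≡ᵇ y′) (H x′ y′) ≡ westDegree x y
    west zero    _  = trans (∑.⨁-cong (suc (2 * m)) (λ _ _ → ∑.⨁-ε (2 + 2 * n))) (∑.⨁-ε (suc (2 * m)))
    west (suc x) x< = ∑.⨁-δ² H (<-trans (n<1+n x) x<) y<
    south : ∀ y → y < 2 + 2 * n → ∑[ x′ < suc (2 * m) ] ∑[ y′ < 2 + 2 * n ] onlyIf (x ≡ᵇ x′) (y ≡ᵇ suc y′) (V x′ y′) ≡ southDegree x y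
    south zero    _  = trans (∑.⨁-cong (suc (2 * m)) (λ x′ _ → trans (∑.⨁-cong (2 + 2 * n) (λ y′ _ → onlyIf-false (x ≡ᵇ x′) (V x′ y′)))
                                                                      (∑.⨁-ε (2 + 2 * n))))
                             (∑.⨁-ε (suc (2 * m)))
    south (suc y) y< = ∑.⨁-δ² V x< (<-trans (n<1+n y) y<)

-- The hexagons of B m n

isEven-2* : ∀ k → isEven (2 * k) ≡ true
isEven-2* zero    = refl
isEven-2* (suc k) = trans (cong isEven (*-suc 2 k)) (isEven-2* k)

isEven-1+2* : ∀ k → isEven (suc (2 * k)) ≡ false
isEven-1+2* zero    = refl
isEven-1+2* (suc k) = trans (cong (isEven ∘ suc) (*-suc 2 k)) (isEven-1+2* k)

isEven-suc : ∀ x → isEven (suc x) ≡ not (isEven x)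
isEven-suc zero          = refl
isEven-suc (suc zero)    = refl
isEven-suc (suc (suc x)) = isEven-suc x

data Parity : ℕ → Set where
  even : ∀ k → Parity (2 * k)
  odd  : ∀ k → Parity (suc (2 * k))

parity : ∀ x → Parity x
parity zero = even 0
parity (suc x) with parity x
... | even k = odd k
... | odd k  = subst Parity (*-suc 2 k) (even (suc k))

half-< : ∀ {j k} → 2 * j < 2 * k → j < k
half-< {j} {k} = *-cancelˡ-< 2 j k

double-suc : ∀ {k m} → suc k ≤ m → 2 + 2 * k ≤ 2 * m
double-suc {k} {m} k< = subst (_≤ 2 * m) (*-suc 2 k) (*-monoʳ-≤ 2 k<)

double-2+ : ∀ {k m} → 2 + k ≤ m → 4 + 2 * k ≤ 2 * m
double-2+ {k} {m} k≤ = subst (_≤ 2 * m) (trans (*-suc 2 (suc k)) (cong (2 +_) (*-suc 2 k))) (*-monoʳ-≤ 2 k≤)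

<∸1⇒2+≤ : ∀ {k m} → k < m ∸ 1 → 2 + k ≤ m
<∸1⇒2+≤ {m = suc m} k< = s≤s k<

2+≤⇒<∸1 : ∀ {k m} → 2 + k ≤ m → k < m ∸ 1
2+≤⇒<∸1 (s≤s k<) = k<

∸-exact : ∀ {x y z} → x ≡ z + y → x ∸ y ≡ z
∸-exact {y = y} {z} eq = trans (cong (_∸ y) eq) (m+n∸n≡m z y)

==ᵖ-sound : ∀ {p q} → T (p ==ᵖ q) → p ≡ q
==ᵖ-sound {a , b} {c , d} t with Equivalence.to T-∧ t
... | s , t′ = cong₂ _,_ (≡ᵇ⇒≡ a c s) (≡ᵇ⇒≡ b d t′)

==ᵖ-refl : ∀ p → T (p ==ᵖ p)
==ᵖ-refl (a , b) = Equivalence.from T-∧ (≡⇒≡ᵇ a a refl , ≡⇒≡ᵇ b b refl)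

==ᵉ-sound : ∀ {e f} → T (e ==ᵉ f) → e ≡ f
==ᵉ-sound {p , q} {r , s} t with Equivalence.to T-∧ t
... | s₁ , s₂ = cong₂ _,_ (==ᵖ-sound s₁) (==ᵖ-sound s₂)

==ᵉ-refl : ∀ e → T (e ==ᵉ e)
==ᵉ-refl (p , q) = Equivalence.from T-∧ (==ᵖ-refl p , ==ᵖ-refl q)

module _ {A : Set} {_==_ : A → A → Bool} (sound : ∀ {a b} → T (a == b) → a ≡ b) (reflexive : ∀ a → T (a == a)) where

  any-==⁻ : ∀ {a} xs → T (any (a ==_) xs) → a ∈ xs
  any-==⁻ xs t = Any.map sound (any⁻ _ xs t)

  any-==⁺ : ∀ {a xs} → a ∈ xs → T (any (a ==_) xs)
  any-==⁺ {a} a∈xs = any⁺ _ (Any.map (λ { refl → reflexive a }) a∈xs)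

horizontal∈⁻ : ∀ {x y hx hy} → horizontal x y ∈ hexEdges (hx , hy) → (x ≡ hx ⊎ x ≡ suc hx) × (y ≡ hy ⊎ y ≡ suc hy)
horizontal∈⁻ (here refl)                                 = inj₁ refl , inj₁ refl
horizontal∈⁻ (there (here refl))                         = inj₂ refl , inj₁ refl
horizontal∈⁻ (there (there (here refl)))                 = inj₁ refl , inj₂ refl
horizontal∈⁻ (there (there (there (here refl))))         = inj₂ refl , inj₂ refl
horizontal∈⁻ (there (there (there (there (here ())))))
horizontal∈⁻ (there (there (there (there (there (here ()))))))

horizontal∈⁺ : ∀ {x y hx hy} → (x ≡ hx ⊎ x ≡ suc hx) → (y ≡ hy ⊎ y ≡ suc hy) → horizontal x y ∈ hexEdges (hx , hy)
horizontal∈⁺ (inj₁ refl) (inj₁ refl) = here refl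
horizontal∈⁺ (inj₂ refl) (inj₁ refl) = there (here refl)
horizontal∈⁺ (inj₁ refl) (inj₂ refl) = there (there (here refl))
horizontal∈⁺ (inj₂ refl) (inj₂ refl) = there (there (there (here refl)))

vertical∈⁻ : ∀ {x y hx hy} → vertical x y ∈ hexEdges (hx , hy) → (x ≡ hx ⊎ x ≡ 2 + hx) × y ≡ hy
vertical∈⁻ (here ())
vertical∈⁻ (there (here ()))
vertical∈⁻ (there (there (here ())))
vertical∈⁻ (there (there (there (here ()))))
vertical∈⁻ (there (there (there (there (here refl)))))         = inj₁ refl , refl
vertical∈⁻ (there (there (there (there (there (here refl)))))) = inj₂ refl , refl

vertical∈⁺ : ∀ {x y hx} → (x ≡ hx ⊎ x ≡ 2 + hx) → vertical x y ∈ hexEdges (hx , y)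
vertical∈⁺ (inj₁ refl) = there (there (there (there (here refl))))
vertical∈⁺ (inj₂ refl) = there (there (there (there (there (here refl)))))

vertex∈⁻ : ∀ {x y hx hy} → (x , y) ∈ hexVertices (hx , hy) → (x ≡ hx ⊎ x ≡ suc hx ⊎ x ≡ 2 + hx) × (y ≡ hy ⊎ y ≡ suc hy)
vertex∈⁻ (here refl)                                          = inj₁ refl , inj₁ refl
vertex∈⁻ (there (here refl))                                  = inj₂ (inj₁ refl) , inj₁ refl
vertex∈⁻ (there (there (here refl)))                          = inj₂ (inj₂ refl) , inj₁ refl
vertex∈⁻ (there (there (there (here refl))))                  = inj₁ refl , inj₂ refl
vertex∈⁻ (there (there (there (there (here refl)))))          = inj₂ (inj₁ refl) , inj₂ refl
vertex∈⁻ (there (there (there (there (there (here refl)))))) = inj₂ (inj₂ refl) , inj₂ refl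

endpoints∈ : ∀ {e h} → e ∈ hexEdges h → proj₁ e ∈ hexVertices h × proj₂ e ∈ hexVertices h
endpoints∈ (here refl)                                          = here refl , there (here refl)
endpoints∈ (there (here refl))                                  = there (here refl) , there (there (here refl))
endpoints∈ (there (there (here refl)))                          = there (there (there (here refl))) , there (there (there (there (here refl))))
endpoints∈ (there (there (there (here refl))))                  = there (there (there (there (here refl)))) , there (there (there (there (there (here refl)))))
endpoints∈ (there (there (there (there (here refl)))))          = here refl , there (there (there (here refl)))
endpoints∈ (there (there (there (there (there (here refl)))))) = there (there (here refl)) , there (there (there (there (there (here refl)))))

module JaggedRectangle (m n : ℕ) where

  hexagonRow : ℕ → List Point
  hexagonRow y = if isEven y then map (λ k → (suc (2 * k) , y)) (upTo (m ∸ 1)) else map (λ k → (2 * k , y)) (upTo m)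

  data Hexagon : Point → Set where
    short : ∀ {k y} → isEven y ≡ true  → y ≤ 2 * n → 2 + k ≤ m → Hexagon (suc (2 * k) , y)
    long  : ∀ {k y} → isEven y ≡ false → y ≤ 2 * n → suc k ≤ m → Hexagon (2 * k , y)

  module _ (P : Point → Set) where

    hexagons⁻ : Any P (hexagonsB m n) → ∃[ h ] Hexagon h × P h
    hexagons⁻ p with applyUpTo⁻ id (map⁻ (concat⁻ (map hexagonRow (upTo (suc (2 * n)))) p))
    ... | y , y< , inRow = row (isEven y) refl inRow
      where
      row : ∀ b → isEven y ≡ b →
            Any P (if b then map (λ k → (suc (2 * k) , y)) (upTo (m ∸ 1)) else map (λ k → (2 * k , y)) (upTo m)) →
            ∃[ h ] Hexagon h × P h
      row true  ev q with applyUpTo⁻ id (map⁻ q)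
      ... | k , k< , Pk = _ , short ev (≤-pred y<) (<∸1⇒2+≤ k<) , Pk
      row false ev q with applyUpTo⁻ id (map⁻ q)
      ... | k , k< , Pk = _ , long ev (≤-pred y<) k< , Pk

    hexagons⁺ : ∀ {h} → Hexagon h → P h → Any P (hexagonsB m n)
    hexagons⁺ {_ , y} hex Ph = concat⁺ (map⁺ (applyUpTo⁺ id (row hex) (s≤s (height hex))))
      where
      height : ∀ {h} → Hexagon h → proj₂ h ≤ 2 * n
      height (short _ y≤ _) = y≤
      height (long  _ y≤ _) = y≤
      row : Hexagon (_ , y) → Any P (hexagonRow y)
      row (short ev _ k≤) rewrite ev = map⁺ (applyUpTo⁺ id Ph (2+≤⇒<∸1 k≤))
      row (long  ev _ k<) rewrite ev = map⁺ (applyUpTo⁺ id Ph k<)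

  -- Opaque, so that the point or edge in T (isVertexB p), T (isEdgeB e) is recovered by unification.
  opaque
    isVertexB : Point → Bool
    isVertexB p = any (λ h → any (p ==ᵖ_) (hexVertices h)) (hexagonsB m n)

    isEdgeB : Point × Point → Bool
    isEdgeB e = any (λ h → any (e ==ᵉ_) (hexEdges h)) (hexagonsB m n)

  opaque
    unfolding isVertexB isEdgeB

    B-lattice : B m n ≡ latticeGraph m n isVertexB isEdgeB
    B-lattice = refl

    edge⁻ : ∀ {e} → T (isEdgeB e) → ∃[ h ] Hexagon h × e ∈ hexEdges h
    edge⁻ {e} t with hexagons⁻ (λ h → T (any (e ==ᵉ_) (hexEdges h))) (any⁻ _ _ t)
    ... | h , hex , t′ = h , hex , any-==⁻ ==ᵉ-sound ==ᵉ-refl (hexEdges h) t′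

    edge⁺ : ∀ {e h} → Hexagon h → e ∈ hexEdges h → T (isEdgeB e)
    edge⁺ hex e∈ = any⁺ _ (hexagons⁺ _ hex (any-==⁺ ==ᵉ-sound ==ᵉ-refl e∈))

    vertex⁻ : ∀ {p} → T (isVertexB p) → ∃[ h ] Hexagon h × p ∈ hexVertices h
    vertex⁻ {p} t with hexagons⁻ (λ h → T (any (p ==ᵖ_) (hexVertices h))) (any⁻ _ _ t)
    ... | h , hex , t′ = h , hex , any-==⁻ ==ᵖ-sound ==ᵖ-refl (hexVertices h) t′

    vertex⁺ : ∀ {p h} → Hexagon h → p ∈ hexVertices h → T (isVertexB p)
    vertex⁺ hex p∈ = any⁺ _ (hexagons⁺ _ hex (any-==⁺ ==ᵖ-sound ==ᵖ-refl p∈))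

  MiddleRow OuterRow : ℕ → Set
  MiddleRow y = 1 ≤ y × y ≤ 2 * n
  OuterRow  y = y ≡ 0 ⊎ y ≡ suc (2 * n)

  long-row-covering : ∀ {y} → MiddleRow y → ∃[ hy ] isEven hy ≡ false × hy ≤ 2 * n × (y ≡ hy ⊎ y ≡ suc hy)
  long-row-covering {y} (1≤y , y≤) with parity y
  ... | odd k        = _ , isEven-1+2* k , y≤ , inj₁ refl
  ... | even (suc k) = _ , isEven-1+2* k , ≤-trans (n≤1+n _) (subst (_≤ 2 * n) (*-suc 2 k) y≤) , inj₂ (*-suc 2 k)

  short-row-covering : ∀ {y} → OuterRow y → ∃[ hy ] isEven hy ≡ true × hy ≤ 2 * n × (y ≡ hy ⊎ y ≡ suc hy)
  short-row-covering (inj₁ refl) = 0 , refl , z≤n , inj₁ refl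
  short-row-covering (inj₂ refl) = 2 * n , isEven-2* n , ≤-refl , inj₂ refl

  long-row-not-outer : ∀ {y hy} → isEven hy ≡ false → hy ≤ 2 * n → (y ≡ hy ⊎ y ≡ suc hy) → OuterRow y → ⊥
  long-row-not-outer ev _   (inj₁ refl) (inj₁ refl) with () ← ev
  long-row-not-outer ev hy≤ (inj₁ refl) (inj₂ refl) = 1+n≰n hy≤
  long-row-not-outer ev _   (inj₂ refl) (inj₂ refl) with () ← trans (sym (isEven-2* n)) ev

  horizontal-middle : ∀ {x y} → MiddleRow y → x < 2 * m → T (isEdgeB (horizontal x y))
  horizontal-middle {x} y∈ x< with long-row-covering y∈ | parity x
  ... | hy , ev , hy≤ , y∈hex | even k = edge⁺ (long ev hy≤ (half-< {k} x<)) (horizontal∈⁺ (inj₁ refl) y∈hex)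
  ... | hy , ev , hy≤ , y∈hex | odd k  = edge⁺ (long ev hy≤ (half-< {k} (<-trans (n<1+n _) x<))) (horizontal∈⁺ (inj₂ refl) y∈hex)

  horizontal-outer : ∀ {x y} → OuterRow y → 1 ≤ x → 2 + x ≤ 2 * m → T (isEdgeB (horizontal x y))
  horizontal-outer {x} y∈ 1≤x x≤ with short-row-covering y∈ | parity x
  ... | hy , ev , hy≤ , y∈hex | odd k =
    edge⁺ (short ev hy≤ (half-< {suc k} (subst (_≤ 2 * m) (sym (cong suc (*-suc 2 k))) x≤))) (horizontal∈⁺ (inj₁ refl) y∈hex)
  ... | hy , ev , hy≤ , y∈hex | even (suc k) =
    edge⁺ (short ev hy≤ (half-< {suc k} (≤-trans (n≤1+n _) x≤))) (horizontal∈⁺ (inj₂ (*-suc 2 k)) y∈hex)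

  horizontal⁻ : ∀ {x y} → T (isEdgeB (horizontal x y)) → x < 2 * m × (OuterRow y → 1 ≤ x × 2 + x ≤ 2 * m)
  horizontal⁻ t with edge⁻ t
  ... | _ , short {k} _ _ k≤ , e∈ with horizontal∈⁻ e∈
  ...   | inj₁ refl , _ = ≤-trans (n≤1+n _) (≤-trans (n≤1+n _) (double-2+ k≤)) , λ _ → s≤s z≤n , ≤-trans (n≤1+n _) (double-2+ k≤)
  ...   | inj₂ refl , _ = ≤-trans (n≤1+n _) (double-2+ k≤) , λ _ → s≤s z≤n , double-2+ k≤
  horizontal⁻ t | _ , long {k} ev hy≤ k< , e∈ with horizontal∈⁻ e∈
  ...   | x∈ , y∈ = below x∈ , λ outer → ⊥-elim (long-row-not-outer ev hy≤ y∈ outer)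
    where
    below : ∀ {x} → (x ≡ 2 * k ⊎ x ≡ suc (2 * k)) → x < 2 * m
    below (inj₁ refl) = ≤-trans (n≤1+n _) (double-suc k<)
    below (inj₂ refl) = double-suc k<

  vertical⁻ : ∀ {x y} → T (isEdgeB (vertical x y)) → y ≤ 2 * n × isEven x ≡ not (isEven y)
  vertical⁻ t with edge⁻ t
  ... | _ , short {k} ev y≤ _ , e∈ with vertical∈⁻ e∈
  ...   | inj₁ refl , refl = y≤ , trans (isEven-1+2* k) (cong not (sym ev))
  ...   | inj₂ refl , refl = y≤ , trans (isEven-1+2* k) (cong not (sym ev))
  vertical⁻ t | _ , long {k} ev y≤ _ , e∈ with vertical∈⁻ e∈
  ...   | inj₁ refl , refl = y≤ , trans (isEven-2* k) (cong not (sym ev))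
  ...   | inj₂ refl , refl = y≤ , trans (isEven-2* k) (cong not (sym ev))

  vertical⁺ : ∀ {x y} → 2 ≤ m → y ≤ 2 * n → x ≤ 2 * m → isEven x ≡ not (isEven y) → T (isEdgeB (vertical x y))
  vertical⁺ {x} {y} 2≤m y≤ x≤ ev with parity y | parity x
  ... | even r | even j with () ← trans (sym (isEven-2* j)) (trans ev (cong not (isEven-2* r)))
  ... | even r | odd zero     = edge⁺ (short (isEven-2* r) y≤ 2≤m) (vertical∈⁺ (inj₁ refl))
  ... | even r | odd (suc j)  = edge⁺ (short {j} (isEven-2* r) y≤ (half-< {suc j} x≤)) (vertical∈⁺ (inj₂ (cong suc (*-suc 2 j))))
  ... | odd r  | even zero    = edge⁺ (long (isEven-1+2* r) y≤ (≤-trans (s≤s z≤n) 2≤m)) (vertical∈⁺ (inj₁ refl))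
  ... | odd r  | even (suc j) = edge⁺ (long (isEven-1+2* r) y≤ (*-cancelˡ-≤ 2 x≤)) (vertical∈⁺ (inj₂ (*-suc 2 j)))
  ... | odd r  | odd j with () ← trans (sym (isEven-1+2* j)) (trans ev (cong not (isEven-1+2* r)))

  endpoints : ∀ {e} → T (isEdgeB e) → T (isVertexB (proj₁ e)) × T (isVertexB (proj₂ e))
  endpoints t with edge⁻ t
  ... | _ , hex , e∈ with endpoints∈ e∈
  ...   | p∈ , q∈ = vertex⁺ hex p∈ , vertex⁺ hex q∈

  vertex-outer⁻ : ∀ {x y} → OuterRow y → T (isVertexB (x , y)) → 1 ≤ x × x < 2 * m
  vertex-outer⁻ outer t with vertex⁻ t
  ... | _ , short {k} _ _ k≤ , p∈ with vertex∈⁻ p∈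
  ...   | inj₁ refl , _        = s≤s z≤n , ≤-trans (n≤1+n _) (≤-trans (n≤1+n _) (double-2+ k≤))
  ...   | inj₂ (inj₁ refl) , _ = s≤s z≤n , ≤-trans (n≤1+n _) (double-2+ k≤)
  ...   | inj₂ (inj₂ refl) , _ = s≤s z≤n , double-2+ k≤
  vertex-outer⁻ outer t | _ , long ev hy≤ _ , p∈ with vertex∈⁻ p∈
  ...   | _ , y∈ = ⊥-elim (long-row-not-outer ev hy≤ y∈ outer)

-- Degrees and row products

xor-not : ∀ a b → ⟦ a xor not b ⟧ + ⟦ a xor b ⟧ ≡ 1
xor-not true  true  = refl
xor-not true  false = refl
xor-not false true  = refl
xor-not false false = refl

xor-true : ∀ a → ⟦ a xor true ⟧ ≡ ⟦ not a ⟧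
xor-true true  = refl
xor-true false = refl

-- With m = 2 + a and n = 1 + b the lattice points of B m n form 4 + 2b rows y of 5 + 2a points x.
module Counting (a b : ℕ) where

  open JaggedRectangle (2 + a) (1 + b)
  open LatticeGraph (2 + a) (1 + b) isVertexB isEdgeB

  2m≡ : 2 * (2 + a) ≡ 4 + 2 * a
  2m≡ = *-distribˡ-+ 2 2 a

  ≤2m : ∀ {x} → x ≤ 4 + 2 * a → x ≤ 2 * (2 + a)
  ≤2m {x} x≤ = subst (x ≤_) (sym 2m≡) x≤

  2n≡ : 2 * (1 + b) ≡ 2 + 2 * b
  2n≡ = *-distribˡ-+ 2 1 b

  ≤2n : ∀ {y} → y ≤ 2 + 2 * b → y ≤ 2 * (1 + b)
  ≤2n {y} y≤ = subst (y ≤_) (sym 2n≡) y≤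

  middle-1 : MiddleRow 1
  middle-1 = s≤s z≤n , ≤2n (s≤s z≤n)

  middle-even : ∀ {q} → q ≤ b → MiddleRow (2 + 2 * q)
  middle-even q≤ = s≤s z≤n , ≤2n (s≤s (s≤s (*-monoʳ-≤ 2 q≤)))

  middle-odd : ∀ {q} → q < b → MiddleRow (3 + 2 * q)
  middle-odd q< = s≤s z≤n , ≤2n (s≤s (s≤s (≤-trans (n≤1+n _) (double-suc q<))))

  middle-4+ : ∀ {q} → q < b → MiddleRow (4 + 2 * q)
  middle-4+ q< = s≤s z≤n , ≤2n (s≤s (s≤s (double-suc q<)))

  outer-top : OuterRow (3 + 2 * b)
  outer-top = inj₂ (cong suc (sym 2n≡))

  column< : ∀ {x} → x ≤ 4 + 2 * a → x < suc (2 * (2 + a))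
  column< x≤ = s≤s (≤2m x≤)

  middle< : ∀ {y} → MiddleRow y → y < 2 + 2 * (1 + b)
  middle< (_ , y≤) = s≤s (≤-trans y≤ (n≤1+n _))

  outer< : ∀ {y} → OuterRow y → y < 2 + 2 * (1 + b)
  outer< (inj₁ refl) = s≤s z≤n
  outer< (inj₂ refl) = ≤-refl

  hEdge-middle : ∀ {x y} → MiddleRow y → x ≤ 3 + 2 * a → T (isEdgeB (horizontal x y))
  hEdge-middle y∈ x≤ = horizontal-middle y∈ (≤2m (s≤s x≤))

  hEdge-last : ∀ {y} → ¬ T (isEdgeB (horizontal (4 + 2 * a) y))
  hEdge-last t = <-irrefl (sym 2m≡) (proj₁ (horizontal⁻ t))

  hEdge-outer : ∀ {x y} → OuterRow y → 1 ≤ x → x ≤ 2 + 2 * a → T (isEdgeB (horizontal x y))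
  hEdge-outer y∈ 1≤x x≤ = horizontal-outer y∈ 1≤x (≤2m (s≤s (s≤s x≤)))

  hEdge-outer-first : ∀ {y} → OuterRow y → ¬ T (isEdgeB (horizontal 0 y))
  hEdge-outer-first y∈ t with () ← proj₁ (proj₂ (horizontal⁻ t) y∈)

  hEdge-outer-last : ∀ {y} → OuterRow y → ¬ T (isEdgeB (horizontal (3 + 2 * a) y))
  hEdge-outer-last y∈ t = <-irrefl refl (subst (5 + 2 * a ≤_) 2m≡ (proj₂ (proj₂ (horizontal⁻ t) y∈)))

  vEdge-present : ∀ {x y} → y ≤ 2 * (1 + b) → x ≤ 4 + 2 * a → isEven x ≡ not (isEven y) → T (isEdgeB (vertical x y))
  vEdge-present y≤ x≤ ev = vertical⁺ (s≤s (s≤s z≤n)) y≤ (≤2m x≤) ev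

  vEdge-absent : ∀ {x y} → isEven x ≡ isEven y → ¬ T (isEdgeB (vertical x y))
  vEdge-absent eq t = not-¬ eq (proj₂ (vertical⁻ t))

  vEdge-count : ∀ {x y} → y ≤ 2 * (1 + b) → x ≤ 4 + 2 * a → ⟦ isEdgeB (vertical x y) ⟧ ≡ ⟦ isEven x xor isEven y ⟧
  vEdge-count {x} {y} y≤ x≤ with isEven x in ex | isEven y in ey
  ... | true  | true  = ⟦⟧-¬T (vEdge-absent (trans ex (sym ey)))
  ... | false | false = ⟦⟧-¬T (vEdge-absent (trans ex (sym ey)))
  ... | true  | false = ⟦⟧-T (vEdge-present y≤ x≤ (trans ex (cong not (sym ey))))
  ... | false | true  = ⟦⟧-T (vEdge-present y≤ x≤ (trans ex (cong not (sym ey))))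

  vEdge-above : ∀ {x y} → 2 * (1 + b) < y → ¬ T (isEdgeB (vertical x y))
  vEdge-above y> t = <⇒≱ y> (proj₁ (vertical⁻ t))

  verticalDegree-middle : ∀ {x y} → MiddleRow y → x ≤ 4 + 2 * a → verticalDegree x y ≡ 1
  verticalDegree-middle {x} {suc y} (_ , y≤) x≤ = begin
    ⟦ isEdgeB (vertical x (suc y)) ⟧ + ⟦ isEdgeB (vertical x y) ⟧
      ≡⟨ cong₂ _+_ (vEdge-count y≤ x≤) (vEdge-count (≤-trans (n≤1+n y) y≤) x≤) ⟩
    ⟦ isEven x xor isEven (suc y) ⟧ + ⟦ isEven x xor isEven y ⟧
      ≡⟨ cong (λ e → ⟦ isEven x xor e ⟧ + ⟦ isEven x xor isEven y ⟧) (isEven-suc y) ⟩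
    ⟦ isEven x xor not (isEven y) ⟧ + ⟦ isEven x xor isEven y ⟧
      ≡⟨ xor-not (isEven x) (isEven y) ⟩
    1 ∎
    where open ≡-Reasoning

  verticalDegree-outer : ∀ {x y} → OuterRow y → x ≤ 4 + 2 * a → verticalDegree x y ≡ ⟦ not (isEven x) ⟧
  verticalDegree-outer {x} (inj₁ refl) x≤ = trans (+-identityʳ _) (trans (vEdge-count z≤n x≤) (xor-true (isEven x)))
  verticalDegree-outer {x} (inj₂ refl) x≤ = begin
    ⟦ isEdgeB (vertical x (suc (2 * (1 + b)))) ⟧ + ⟦ isEdgeB (vertical x (2 * (1 + b))) ⟧
      ≡⟨ cong₂ _+_ (⟦⟧-¬T (vEdge-above {x} ≤-refl)) (vEdge-count ≤-refl x≤) ⟩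
    ⟦ isEven x xor isEven (2 * (1 + b)) ⟧
      ≡⟨ cong (λ e → ⟦ isEven x xor e ⟧) (isEven-2* (1 + b)) ⟩
    ⟦ isEven x xor true ⟧
      ≡⟨ xor-true (isEven x) ⟩
    ⟦ not (isEven x) ⟧ ∎
    where open ≡-Reasoning

  even≤ : ∀ {q} → q ≤ a → 2 + 2 * q ≤ 2 + 2 * a
  even≤ q≤ = s≤s (s≤s (*-monoʳ-≤ 2 q≤))

  odd≤ : ∀ {q} → q < a → 3 + 2 * q ≤ 2 + 2 * a
  odd≤ q< = s≤s (s≤s (≤-trans (n≤1+n _) (double-suc q<)))

  deg-middle-first : ∀ {y} → MiddleRow y → deg G (0 , y) ≡ 2
  deg-middle-first y∈ = trans (deg-lattice (column< z≤n) (middle< y∈))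
    (cong₂ _+_ (cong (_+ 0) (⟦⟧-T (hEdge-middle y∈ z≤n))) (verticalDegree-middle y∈ z≤n))

  deg-middle-inner : ∀ {x y} → MiddleRow y → x ≤ 2 + 2 * a → deg G (suc x , y) ≡ 3
  deg-middle-inner y∈ x≤ = trans (deg-lattice (column< (s≤s (≤-trans x≤ (n≤1+n _)))) (middle< y∈))
    (cong₂ _+_ (cong₂ _+_ (⟦⟧-T (hEdge-middle y∈ (s≤s x≤))) (⟦⟧-T (hEdge-middle y∈ (≤-trans x≤ (n≤1+n _)))))
               (verticalDegree-middle y∈ (s≤s (≤-trans x≤ (n≤1+n _)))))

  deg-middle-last : ∀ {y} → MiddleRow y → deg G (4 + 2 * a , y) ≡ 2
  deg-middle-last {y} y∈ = trans (deg-lattice (column< ≤-refl) (middle< y∈))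
    (cong₂ _+_ (cong₂ _+_ (⟦⟧-¬T (hEdge-last {y})) (⟦⟧-T (hEdge-middle y∈ ≤-refl))) (verticalDegree-middle y∈ ≤-refl))

  deg-outer-first : ∀ {y} → OuterRow y → deg G (1 , y) ≡ 2
  deg-outer-first y∈ = trans (deg-lattice (column< (s≤s z≤n)) (outer< y∈))
    (cong₂ _+_ (cong₂ _+_ (⟦⟧-T (hEdge-outer y∈ (s≤s z≤n) (s≤s z≤n))) (⟦⟧-¬T (hEdge-outer-first y∈)))
               (verticalDegree-outer y∈ (s≤s z≤n)))

  deg-outer-even : ∀ {q y} → OuterRow y → q ≤ a → deg G (2 + 2 * q , y) ≡ 2
  deg-outer-even {q} y∈ q≤ = trans (deg-lattice (column< (≤-trans (even≤ q≤) (≤-trans (n≤1+n _) (n≤1+n _)))) (outer< y∈))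
    (cong₂ _+_ (cong₂ _+_ (⟦⟧-T (hEdge-outer y∈ (s≤s z≤n) (even≤ q≤))) (⟦⟧-T (hEdge-outer y∈ (s≤s z≤n) (≤-trans (n≤1+n _) (even≤ q≤)))))
               (trans (verticalDegree-outer y∈ (≤-trans (even≤ q≤) (≤-trans (n≤1+n _) (n≤1+n _)))) (cong (⟦_⟧ ∘ not) (isEven-2* q))))

  deg-outer-odd : ∀ {q y} → OuterRow y → q < a → deg G (3 + 2 * q , y) ≡ 3
  deg-outer-odd {q} y∈ q< = trans (deg-lattice (column< (≤-trans (odd≤ q<) (≤-trans (n≤1+n _) (n≤1+n _)))) (outer< y∈))
    (cong₂ _+_ (cong₂ _+_ (⟦⟧-T (hEdge-outer y∈ (s≤s z≤n) (odd≤ q<))) (⟦⟧-T (hEdge-outer y∈ (s≤s z≤n) (≤-trans (n≤1+n _) (odd≤ q<)))))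
               (trans (verticalDegree-outer y∈ (≤-trans (odd≤ q<) (≤-trans (n≤1+n _) (n≤1+n _)))) (cong (⟦_⟧ ∘ not) (isEven-1+2* q))))

  deg-outer-last : ∀ {y} → OuterRow y → deg G (3 + 2 * a , y) ≡ 2
  deg-outer-last y∈ = trans (deg-lattice (column< (n≤1+n _)) (outer< y∈))
    (cong₂ _+_ (cong₂ _+_ (⟦⟧-¬T (hEdge-outer-last y∈)) (⟦⟧-T (hEdge-outer y∈ (s≤s z≤n) ≤-refl)))
               (trans (verticalDegree-outer y∈ (n≤1+n _)) (cong (⟦_⟧ ∘ not) (isEven-1+2* a))))

  by-rows : ∀ (f : ℕ → ℕ → ℕ) → ∏[ x < suc (2 * (2 + a)) ] ∏[ y < 2 + 2 * (1 + b) ] f x y ≡ ∏[ y < 4 + 2 * b ] ∏[ x < 5 + 2 * a ] f x y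
  by-rows f = trans (∏.⨁-swap f (suc (2 * (2 + a))) (2 + 2 * (1 + b)))
                    (cong₂ (λ k l → ∏[ y < k ] ∏[ x < l ] f x y) (cong (2 +_) 2n≡) (cong suc 2m≡))

  vertex-start : ∀ {x y} → T (isEdgeB (horizontal x y)) → T (isVertexB (x , y))
  vertex-start t = proj₁ (endpoints t)

  vertex-end : ∀ {x y} → T (isEdgeB (horizontal x y)) → T (isVertexB (suc x , y))
  vertex-end t = proj₂ (endpoints t)

  module VertexProduct (F : ℕ → ℕ) where
    open Monomial (F 2) (F 3) 1

    pointWeight : ℕ → ℕ → ℕ
    pointWeight x y = if isVertexB (x , y) then F (deg G (x , y)) else 1

    point-deg : ∀ {x y d} → T (isVertexB (x , y)) → deg G (x , y) ≡ d → pointWeight x y ≡ F d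
    point-deg t eq = trans (if-T t) (cong F eq)

    point-2 : ∀ x {y} → T (isVertexB (x , y)) → deg G (x , y) ≡ 2 → pointWeight x y ≡ ⟪ ⟨ 1 , 0 , 0 ⟩ ⟫
    point-2 x t eq = trans (point-deg t eq) (sym ⟪u⟫)

    point-3 : ∀ x {y} → T (isVertexB (x , y)) → deg G (x , y) ≡ 3 → pointWeight x y ≡ ⟪ ⟨ 0 , 1 , 0 ⟩ ⟫
    point-3 x t eq = trans (point-deg t eq) (sym ⟪v⟫)

    vertex-row-middle : ∀ {y} → MiddleRow y → ∏[ x < 5 + 2 * a ] pointWeight x y ≡ ⟪ ⟨ 2 , 3 + 2 * a , 0 ⟩ ⟫
    vertex-row-middle {y} y∈ = trans (∏-row (λ x → pointWeight x y) a
      (point-2 0 (vertex-start (hEdge-middle y∈ z≤n)) (deg-middle-first y∈))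
      (point-3 1 (vertex-start (hEdge-middle y∈ (s≤s z≤n))) (deg-middle-inner {0} y∈ z≤n))
      (point-3 (2 + 2 * a) (vertex-start (hEdge-middle y∈ (n≤1+n _))) (deg-middle-inner {1 + 2 * a} y∈ (n≤1+n _)))
      (point-3 (3 + 2 * a) (vertex-start (hEdge-middle y∈ ≤-refl)) (deg-middle-inner {2 + 2 * a} y∈ ≤-refl))
      (point-2 (4 + 2 * a) (vertex-end (hEdge-middle y∈ ≤-refl)) (deg-middle-last y∈))
      (λ q q< → point-3 (2 + 2 * q) (vertex-start (hEdge-middle y∈ (≤-trans (even≤ (<⇒≤ q<)) (n≤1+n _)))) (deg-middle-inner {1 + 2 * q} y∈ (≤-trans (n≤1+n _) (even≤ (<⇒≤ q<)))))
      (λ q q< → point-3 (3 + 2 * q) (vertex-start (hEdge-middle y∈ (≤-trans (odd≤ q<) (n≤1+n _)))) (deg-middle-inner {2 + 2 * q} y∈ (even≤ (<⇒≤ q<)))))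
      (⟪⟫-cong (solve (a ∷ [])) (solve (a ∷ [])) (solve (a ∷ [])))

    no-point : ∀ x {y} → ¬ T (isVertexB (x , y)) → pointWeight x y ≡ ⟪ ⟨ 0 , 0 , 0 ⟩ ⟫
    no-point x ¬t = trans (if-¬T ¬t) (sym ⟪0⟫)

    vertex-row-outer : ∀ {y} → OuterRow y → ∏[ x < 5 + 2 * a ] pointWeight x y ≡ ⟪ ⟨ 3 + a , a , 0 ⟩ ⟫
    vertex-row-outer {y} y∈ = trans (∏-row (λ x → pointWeight x y) a
      (no-point 0 (λ t → 1+n≰n (proj₁ (vertex-outer⁻ y∈ t))))
      (point-2 1 (vertex-start (hEdge-outer y∈ (s≤s z≤n) (s≤s z≤n))) (deg-outer-first y∈))
      (point-2 (2 + 2 * a) (vertex-start (hEdge-outer y∈ (s≤s z≤n) (even≤ ≤-refl))) (deg-outer-even y∈ ≤-refl))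
      (point-2 (3 + 2 * a) (vertex-end (hEdge-outer y∈ (s≤s z≤n) (even≤ ≤-refl))) (deg-outer-last y∈))
      (no-point (4 + 2 * a) (λ t → <-irrefl (sym 2m≡) (proj₂ (vertex-outer⁻ y∈ t))))
      (λ q q< → point-2 (2 + 2 * q) (vertex-start (hEdge-outer y∈ (s≤s z≤n) (even≤ (<⇒≤ q<)))) (deg-outer-even y∈ (<⇒≤ q<)))
      (λ q q< → point-3 (3 + 2 * q) (vertex-start (hEdge-outer y∈ (s≤s z≤n) (odd≤ q<))) (deg-outer-odd y∈ q<)))
      (⟪⟫-cong (solve (a ∷ [])) (solve (a ∷ [])) (solve (a ∷ [])))

    vertex-product : ∏V G (F ∘ deg G) ≡ ⟪ ⟨ 10 + 2 * a + 4 * b , 6 + 6 * a + 6 * b + 4 * a * b , 0 ⟩ ⟫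
    vertex-product = begin
      ∏V G (F ∘ deg G)
        ≡⟨ ∏V-lattice (F ∘ deg G) ⟩
      ∏[ x < suc (2 * (2 + a)) ] ∏[ y < 2 + 2 * (1 + b) ] pointWeight x y
        ≡⟨ by-rows pointWeight ⟩
      ∏[ y < 4 + 2 * b ] ∏[ x < 5 + 2 * a ] pointWeight x y
        ≡⟨ trans (∏-column (λ y → ∏[ x < 5 + 2 * a ] pointWeight x y) b
             (vertex-row-outer (inj₁ refl)) (vertex-row-middle middle-1) (vertex-row-middle (middle-even ≤-refl)) (vertex-row-outer outer-top)
             (λ q q< → vertex-row-middle (middle-even (<⇒≤ q<))) (λ q q< → vertex-row-middle (middle-odd q<)))
             (⟪⟫-cong (solve (a ∷ b ∷ [])) (solve (a ∷ b ∷ [])) (solve (a ∷ b ∷ []))) ⟩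
      ⟪ ⟨ 10 + 2 * a + 4 * b , 6 + 6 * a + 6 * b + 4 * a * b , 0 ⟩ ⟫ ∎
      where open ≡-Reasoning

  module EdgeProduct (g : ℕ → ℕ → ℕ) (g-sym : g 3 2 ≡ g 2 3) where
    open Monomial (g 2 2) (g 2 3) (g 3 3)

    F : Point → Point → ℕ
    F p q = g (deg G p) (deg G q)

    edge : ∀ e {d d′ ε} → T (isEdgeB e) → deg G (proj₁ e) ≡ d → deg G (proj₂ e) ≡ d′ → g d d′ ≡ ⟪ ε ⟫ → weight F e ≡ ⟪ ε ⟫
    edge e t p q r = trans (if-T t) (trans (cong₂ g p q) r)

    no-edge : ∀ e → ¬ T (isEdgeB e) → weight F e ≡ ⟪ ⟨ 0 , 0 , 0 ⟩ ⟫
    no-edge e ¬t = trans (if-¬T ¬t) (sym ⟪0⟫)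

    g22 : g 2 2 ≡ ⟪ ⟨ 1 , 0 , 0 ⟩ ⟫
    g22 = sym ⟪u⟫
    g23 : g 2 3 ≡ ⟪ ⟨ 0 , 1 , 0 ⟩ ⟫
    g23 = sym ⟪v⟫
    g32 : g 3 2 ≡ ⟪ ⟨ 0 , 1 , 0 ⟩ ⟫
    g32 = trans g-sym g23
    g33 : g 3 3 ≡ ⟪ ⟨ 0 , 0 , 1 ⟩ ⟫
    g33 = sym ⟪w⟫

    hWeight vWeight : ℕ → ℕ → ℕ
    hWeight x y = weight F (horizontal x y)
    vWeight x y = weight F (vertical x y)

    horizontal-row-middle : ∀ {y} → MiddleRow y → ∏[ x < 5 + 2 * a ] hWeight x y ≡ ⟪ ⟨ 0 , 2 , 2 + 2 * a ⟩ ⟫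
    horizontal-row-middle {y} y∈ = trans (∏-row (λ x → hWeight x y) a
      (edge (horizontal 0 y) (hEdge-middle y∈ z≤n) (deg-middle-first y∈) (deg-middle-inner {0} y∈ z≤n) g23)
      (edge (horizontal 1 y) (hEdge-middle y∈ (s≤s z≤n)) (deg-middle-inner {0} y∈ z≤n) (deg-middle-inner {1} y∈ (s≤s z≤n)) g33)
      (edge (horizontal (2 + 2 * a) y) (hEdge-middle y∈ (n≤1+n _)) (deg-middle-inner {1 + 2 * a} y∈ (n≤1+n _)) (deg-middle-inner {2 + 2 * a} y∈ ≤-refl) g33)
      (edge (horizontal (3 + 2 * a) y) (hEdge-middle y∈ ≤-refl) (deg-middle-inner {2 + 2 * a} y∈ ≤-refl) (deg-middle-last y∈) g32)
      (no-edge (horizontal (4 + 2 * a) y) hEdge-last)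
      (λ q q< → edge (horizontal (2 + 2 * q) y) (hEdge-middle y∈ (≤-trans (even≤ (<⇒≤ q<)) (n≤1+n _)))
                     (deg-middle-inner {1 + 2 * q} y∈ (≤-trans (n≤1+n _) (even≤ (<⇒≤ q<)))) (deg-middle-inner {2 + 2 * q} y∈ (even≤ (<⇒≤ q<))) g33)
      (λ q q< → edge (horizontal (3 + 2 * q) y) (hEdge-middle y∈ (≤-trans (odd≤ q<) (n≤1+n _)))
                     (deg-middle-inner {2 + 2 * q} y∈ (even≤ (<⇒≤ q<))) (deg-middle-inner {3 + 2 * q} y∈ (odd≤ q<)) g33))
      (⟪⟫-cong (solve (a ∷ [])) (solve (a ∷ [])) (solve (a ∷ [])))

    horizontal-row-outer : ∀ {y} → OuterRow y → ∏[ x < 5 + 2 * a ] hWeight x y ≡ ⟪ ⟨ 2 , 2 * a , 0 ⟩ ⟫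
    horizontal-row-outer {y} y∈ = trans (∏-row (λ x → hWeight x y) a
      (no-edge (horizontal 0 y) (hEdge-outer-first y∈))
      (edge (horizontal 1 y) (hEdge-outer y∈ (s≤s z≤n) (s≤s z≤n)) (deg-outer-first y∈) (deg-outer-even {0} y∈ z≤n) g22)
      (edge (horizontal (2 + 2 * a) y) (hEdge-outer y∈ (s≤s z≤n) (even≤ ≤-refl)) (deg-outer-even y∈ ≤-refl) (deg-outer-last y∈) g22)
      (no-edge (horizontal (3 + 2 * a) y) (hEdge-outer-last y∈))
      (no-edge (horizontal (4 + 2 * a) y) hEdge-last)
      (λ q q< → edge (horizontal (2 + 2 * q) y) (hEdge-outer y∈ (s≤s z≤n) (even≤ (<⇒≤ q<))) (deg-outer-even y∈ (<⇒≤ q<)) (deg-outer-odd y∈ q<) g23)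
      (λ q q< → edge (horizontal (3 + 2 * q) y) (hEdge-outer y∈ (s≤s z≤n) (odd≤ q<)) (deg-outer-odd y∈ q<)
                     (trans (cong (λ x → deg G (2 + x , y)) (sym (*-suc 2 q))) (deg-outer-even y∈ q<)) g32))
      (⟪⟫-cong (solve (a ∷ [])) (solve (a ∷ [])) (solve (a ∷ [])))

    vertical-row-bottom : ∏[ x < 5 + 2 * a ] vWeight x 0 ≡ ⟪ ⟨ 0 , 2 , a ⟩ ⟫
    vertical-row-bottom = trans (∏-row (λ x → vWeight x 0) a
      (no-edge (vertical 0 0) (vEdge-absent refl))
      (edge (vertical 1 0) (vEdge-present z≤n (s≤s z≤n) refl) (deg-outer-first (inj₁ refl)) (deg-middle-inner {0} middle-1 z≤n) g23)
      (no-edge (vertical (2 + 2 * a) 0) (vEdge-absent (isEven-2* a)))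
      (edge (vertical (3 + 2 * a) 0) (vEdge-present z≤n (n≤1+n _) (isEven-1+2* a)) (deg-outer-last (inj₁ refl)) (deg-middle-inner {2 + 2 * a} middle-1 ≤-refl) g23)
      (no-edge (vertical (4 + 2 * a) 0) (vEdge-absent (isEven-2* a)))
      (λ q q< → no-edge (vertical (2 + 2 * q) 0) (vEdge-absent (isEven-2* q)))
      (λ q q< → edge (vertical (3 + 2 * q) 0) (vEdge-present z≤n (≤-trans (odd≤ q<) (≤-trans (n≤1+n _) (n≤1+n _))) (isEven-1+2* q))
                     (deg-outer-odd (inj₁ refl) q<) (deg-middle-inner {2 + 2 * q} middle-1 (even≤ (<⇒≤ q<))) g33))
      (⟪⟫-cong (solve (a ∷ [])) (solve (a ∷ [])) (solve (a ∷ [])))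

    vertical-row-top : ∏[ x < 5 + 2 * a ] vWeight x (2 + 2 * b) ≡ ⟪ ⟨ 0 , 2 , a ⟩ ⟫
    vertical-row-top = trans (∏-row (λ x → vWeight x (2 + 2 * b)) a
      (no-edge (vertical 0 y) (vEdge-absent (sym top-even)))
      (edge (vertical 1 y) (vEdge-present y≤ (s≤s z≤n) opposite) (deg-middle-inner {0} y∈ z≤n) (deg-outer-first outer-top) g32)
      (no-edge (vertical (2 + 2 * a) y) (vEdge-absent (trans (isEven-2* a) (sym top-even))))
      (edge (vertical (3 + 2 * a) y) (vEdge-present y≤ (n≤1+n _) (trans (isEven-1+2* a) opposite))
            (deg-middle-inner {2 + 2 * a} y∈ ≤-refl) (deg-outer-last outer-top) g32)
      (no-edge (vertical (4 + 2 * a) y) (vEdge-absent (trans (isEven-2* a) (sym top-even))))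
      (λ q q< → no-edge (vertical (2 + 2 * q) y) (vEdge-absent (trans (isEven-2* q) (sym top-even))))
      (λ q q< → edge (vertical (3 + 2 * q) y) (vEdge-present y≤ (≤-trans (odd≤ q<) (≤-trans (n≤1+n _) (n≤1+n _))) (trans (isEven-1+2* q) opposite))
                     (deg-middle-inner {2 + 2 * q} y∈ (even≤ (<⇒≤ q<))) (deg-outer-odd outer-top q<) g33))
      (⟪⟫-cong (solve (a ∷ [])) (solve (a ∷ [])) (solve (a ∷ [])))
      where
      y : ℕ
      y = 2 + 2 * b
      y∈ : MiddleRow y
      y∈ = middle-even ≤-refl
      y≤ : y ≤ 2 * (1 + b)
      y≤ = proj₂ y∈
      top-even : isEven y ≡ true
      top-even = isEven-2* b
      opposite : false ≡ not (isEven y)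
      opposite = cong not (sym top-even)

    vertical-row-even : ∀ {y} → isEven y ≡ true → MiddleRow y → MiddleRow (suc y) → ∏[ x < 5 + 2 * a ] vWeight x y ≡ ⟪ ⟨ 0 , 0 , 2 + a ⟩ ⟫
    vertical-row-even {y} ev y∈ y′∈ = trans (∏-row (λ x → vWeight x y) a
      (no-edge (vertical 0 y) (vEdge-absent (sym ev)))
      (edge (vertical 1 y) (vEdge-present (proj₂ y∈) (s≤s z≤n) opposite) (deg-middle-inner {0} y∈ z≤n) (deg-middle-inner {0} y′∈ z≤n) g33)
      (no-edge (vertical (2 + 2 * a) y) (vEdge-absent (trans (isEven-2* a) (sym ev))))
      (edge (vertical (3 + 2 * a) y) (vEdge-present (proj₂ y∈) (n≤1+n _) (trans (isEven-1+2* a) opposite))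
            (deg-middle-inner {2 + 2 * a} y∈ ≤-refl) (deg-middle-inner {2 + 2 * a} y′∈ ≤-refl) g33)
      (no-edge (vertical (4 + 2 * a) y) (vEdge-absent (trans (isEven-2* a) (sym ev))))
      (λ q q< → no-edge (vertical (2 + 2 * q) y) (vEdge-absent (trans (isEven-2* q) (sym ev))))
      (λ q q< → edge (vertical (3 + 2 * q) y) (vEdge-present (proj₂ y∈) (≤-trans (odd≤ q<) (≤-trans (n≤1+n _) (n≤1+n _))) (trans (isEven-1+2* q) opposite))
                     (deg-middle-inner {2 + 2 * q} y∈ (even≤ (<⇒≤ q<))) (deg-middle-inner {2 + 2 * q} y′∈ (even≤ (<⇒≤ q<))) g33))
      (⟪⟫-cong (solve (a ∷ [])) (solve (a ∷ [])) (solve (a ∷ [])))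
      where
      opposite : false ≡ not (isEven y)
      opposite = cong not (sym ev)

    vertical-row-odd : ∀ {y} → isEven y ≡ false → MiddleRow y → MiddleRow (suc y) → ∏[ x < 5 + 2 * a ] vWeight x y ≡ ⟪ ⟨ 2 , 0 , 1 + a ⟩ ⟫
    vertical-row-odd {y} ev y∈ y′∈ = trans (∏-row (λ x → vWeight x y) a
      (edge (vertical 0 y) (vEdge-present (proj₂ y∈) z≤n opposite) (deg-middle-first y∈) (deg-middle-first y′∈) g22)
      (no-edge (vertical 1 y) (vEdge-absent (sym ev)))
      (edge (vertical (2 + 2 * a) y) (vEdge-present (proj₂ y∈) (≤-trans (n≤1+n _) (n≤1+n _)) (trans (isEven-2* a) opposite))
            (deg-middle-inner {1 + 2 * a} y∈ (n≤1+n _)) (deg-middle-inner {1 + 2 * a} y′∈ (n≤1+n _)) g33)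
      (no-edge (vertical (3 + 2 * a) y) (vEdge-absent (trans (isEven-1+2* a) (sym ev))))
      (edge (vertical (4 + 2 * a) y) (vEdge-present (proj₂ y∈) ≤-refl (trans (isEven-2* a) opposite)) (deg-middle-last y∈) (deg-middle-last y′∈) g22)
      (λ q q< → edge (vertical (2 + 2 * q) y) (vEdge-present (proj₂ y∈) (≤-trans (even≤ (<⇒≤ q<)) (≤-trans (n≤1+n _) (n≤1+n _))) (trans (isEven-2* q) opposite))
                     (deg-middle-inner {1 + 2 * q} y∈ (≤-trans (n≤1+n _) (even≤ (<⇒≤ q<)))) (deg-middle-inner {1 + 2 * q} y′∈ (≤-trans (n≤1+n _) (even≤ (<⇒≤ q<)))) g33)
      (λ q q< → no-edge (vertical (3 + 2 * q) y) (vEdge-absent (trans (isEven-1+2* q) (sym ev)))))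
      (⟪⟫-cong (solve (a ∷ [])) (solve (a ∷ [])) (solve (a ∷ [])))
      where
      opposite : true ≡ not (isEven y)
      opposite = cong not (sym ev)

    vertical-row-none : ∏[ x < 5 + 2 * a ] vWeight x (3 + 2 * b) ≡ ⟪ ⟨ 0 , 0 , 0 ⟩ ⟫
    vertical-row-none = trans (∏.⨁-cong {g = λ _ → 1} (5 + 2 * a) (λ x _ → trans (no-edge (vertical x (3 + 2 * b)) (vEdge-above {x} above)) ⟪0⟫))
                        (trans (∏.⨁-ε (5 + 2 * a)) (sym ⟪0⟫))
      where
      above : 2 * (1 + b) < 3 + 2 * b
      above = subst (_< 3 + 2 * b) (sym 2n≡) ≤-refl

    horizontal-product : ∏[ y < 4 + 2 * b ] ∏[ x < 5 + 2 * a ] hWeight x y ≡ ⟪ ⟨ 4 , 4 + 4 * a + 4 * b , 4 + 4 * a + 4 * b + 4 * a * b ⟩ ⟫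
    horizontal-product = trans (∏-column (λ y → ∏[ x < 5 + 2 * a ] hWeight x y) b
      (horizontal-row-outer (inj₁ refl)) (horizontal-row-middle middle-1) (horizontal-row-middle (middle-even ≤-refl)) (horizontal-row-outer outer-top)
      (λ q q< → horizontal-row-middle (middle-even (<⇒≤ q<))) (λ q q< → horizontal-row-middle (middle-odd q<)))
      (⟪⟫-cong (solve (a ∷ b ∷ [])) (solve (a ∷ b ∷ [])) (solve (a ∷ b ∷ [])))

    vertical-product : ∏[ y < 4 + 2 * b ] ∏[ x < 5 + 2 * a ] vWeight x y ≡ ⟪ ⟨ 2 + 2 * b , 4 , 1 + 3 * a + 3 * b + 2 * a * b ⟩ ⟫
    vertical-product = trans (∏-column (λ y → ∏[ x < 5 + 2 * a ] vWeight x y) b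
      vertical-row-bottom (vertical-row-odd refl middle-1 (middle-even z≤n)) vertical-row-top vertical-row-none
      (λ q q< → vertical-row-even (isEven-2* q) (middle-even (<⇒≤ q<)) (middle-odd q<))
      (λ q q< → vertical-row-odd (isEven-1+2* q) (middle-odd q<) (middle-4+ q<)))
      (⟪⟫-cong (solve (a ∷ b ∷ [])) (solve (a ∷ b ∷ [])) (solve (a ∷ b ∷ [])))

    edge-product : ∏E G F ≡ ⟪ ⟨ 6 + 2 * b , 8 + 4 * a + 4 * b , 5 + 7 * a + 7 * b + 6 * a * b ⟩ ⟫
    edge-product = begin
      ∏E G F
        ≡⟨ ∏E-lattice F ⟩
      ∏[ x < suc (2 * (2 + a)) ] ∏[ y < 2 + 2 * (1 + b) ] (hWeight x y * vWeight x y)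
        ≡⟨ ∏.⨁²-distrib hWeight vWeight (suc (2 * (2 + a))) (2 + 2 * (1 + b)) ⟩
      ∏[ x < suc (2 * (2 + a)) ] ∏[ y < 2 + 2 * (1 + b) ] hWeight x y * ∏[ x < suc (2 * (2 + a)) ] ∏[ y < 2 + 2 * (1 + b) ] vWeight x y
        ≡⟨ cong₂ _*_ (by-rows hWeight) (by-rows vWeight) ⟩
      ∏[ y < 4 + 2 * b ] ∏[ x < 5 + 2 * a ] hWeight x y * ∏[ y < 4 + 2 * b ] ∏[ x < 5 + 2 * a ] vWeight x y
        ≡⟨ cong₂ _*_ horizontal-product vertical-product ⟩
      ⟪ ⟨ 4 , 4 + 4 * a + 4 * b , 4 + 4 * a + 4 * b + 4 * a * b ⟩ ⟫ * ⟪ ⟨ 2 + 2 * b , 4 , 1 + 3 * a + 3 * b + 2 * a * b ⟩ ⟫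
        ≡⟨ sym (⟪⟫-⊕ _ _) ⟩
      ⟪ ⟨ 4 , 4 + 4 * a + 4 * b , 4 + 4 * a + 4 * b + 4 * a * b ⟩ ⊕ ⟨ 2 + 2 * b , 4 , 1 + 3 * a + 3 * b + 2 * a * b ⟩ ⟫
        ≡⟨ ⟪⟫-cong (solve (a ∷ b ∷ [])) (solve (a ∷ b ∷ [])) (solve (a ∷ b ∷ [])) ⟩
      ⟪ ⟨ 6 + 2 * b , 8 + 4 * a + 4 * b , 5 + 7 * a + 7 * b + 6 * a * b ⟩ ⟫ ∎
      where open ≡-Reasoning

-- Degree-based products of B m n

vertex-formula : ∀ {m n} → 2 ≤ m → 1 ≤ n → (F : ℕ → ℕ) →
                 ∏V (B m n) (F ∘ deg (B m n)) ≡ F 2 ^ (2 * m + 4 * n + 2) * F 3 ^ ((4 * m * n + 2 * m) ∸ (2 * n + 4))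
vertex-formula {suc (suc a)} {suc b} _ _ F = begin
  ∏V G (F ∘ deg G)   ≡⟨ cong (λ G → ∏V G (F ∘ deg G)) B-lattice ⟩
  ∏V G′ (F ∘ deg G′) ≡⟨ vertex-product ⟩
  ⟪ ⟨ 10 + 2 * a + 4 * b , 6 + 6 * a + 6 * b + 4 * a * b , 0 ⟩ ⟫
    ≡⟨ ⟪⟫-cong degree-2 (sym degree-3) refl ⟩
  ⟪ ⟨ 2 * (2 + a) + 4 * (1 + b) + 2 , (4 * (2 + a) * (1 + b) + 2 * (2 + a)) ∸ (2 * (1 + b) + 4) , 0 ⟩ ⟫
    ≡⟨ trans (⟪⟫-def _ _ 0) (*-identityʳ _) ⟩
  F 2 ^ (2 * (2 + a) + 4 * (1 + b) + 2) * F 3 ^ ((4 * (2 + a) * (1 + b) + 2 * (2 + a)) ∸ (2 * (1 + b) + 4)) ∎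
  where
  open ≡-Reasoning
  open JaggedRectangle (2 + a) (1 + b)
  open Counting a b
  open VertexProduct F
  open Monomial (F 2) (F 3) 1
  G G′ : FinGraph Point
  G  = B (2 + a) (1 + b)
  G′ = latticeGraph (2 + a) (1 + b) isVertexB isEdgeB
  degree-2 : 10 + 2 * a + 4 * b ≡ 2 * (2 + a) + 4 * (1 + b) + 2
  degree-2 = solve (a ∷ b ∷ [])
  degree-3 : (4 * (2 + a) * (1 + b) + 2 * (2 + a)) ∸ (2 * (1 + b) + 4) ≡ 6 + 6 * a + 6 * b + 4 * a * b
  degree-3 = ∸-exact split
    where
    split : 4 * (2 + a) * (1 + b) + 2 * (2 + a) ≡ 6 + 6 * a + 6 * b + 4 * a * b + (2 * (1 + b) + 4)
    split = solve (a ∷ b ∷ [])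
vertex-formula {zero}        ()        _  _
vertex-formula {suc zero}    (s≤s ())  _  _
vertex-formula {suc (suc a)} {zero}  _ () _

edge-formula : ∀ {m n} → 2 ≤ m → 1 ≤ n → (g : ℕ → ℕ → ℕ) → g 3 2 ≡ g 2 3 →
               ∏E (B m n) (λ u v → g (deg (B m n) u) (deg (B m n) v)) ≡
               g 2 2 ^ (2 * n + 4) * g 2 3 ^ ((4 * m + 4 * n) ∸ 4) * g 3 3 ^ ((6 * m * n + m) ∸ (5 * n + 4))
edge-formula {suc (suc a)} {suc b} _ _ g g-sym = begin
  ∏E G (λ u v → g (deg G u) (deg G v))    ≡⟨ cong (λ G → ∏E G (λ u v → g (deg G u) (deg G v))) B-lattice ⟩
  ∏E G′ (λ u v → g (deg G′ u) (deg G′ v)) ≡⟨ edge-product ⟩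
  ⟪ ⟨ 6 + 2 * b , 8 + 4 * a + 4 * b , 5 + 7 * a + 7 * b + 6 * a * b ⟩ ⟫
    ≡⟨ ⟪⟫-cong edges-22 (sym edges-23) (sym edges-33) ⟩
  ⟪ ⟨ 2 * (1 + b) + 4 , (4 * (2 + a) + 4 * (1 + b)) ∸ 4 , (6 * (2 + a) * (1 + b) + (2 + a)) ∸ (5 * (1 + b) + 4) ⟩ ⟫
    ≡⟨ ⟪⟫-def _ _ _ ⟩
  g 2 2 ^ (2 * (1 + b) + 4) * g 2 3 ^ ((4 * (2 + a) + 4 * (1 + b)) ∸ 4) * g 3 3 ^ ((6 * (2 + a) * (1 + b) + (2 + a)) ∸ (5 * (1 + b) + 4)) ∎
  where
  open ≡-Reasoning
  open JaggedRectangle (2 + a) (1 + b)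
  open Counting a b
  open EdgeProduct g g-sym
  open Monomial (g 2 2) (g 2 3) (g 3 3)
  G G′ : FinGraph Point
  G  = B (2 + a) (1 + b)
  G′ = latticeGraph (2 + a) (1 + b) isVertexB isEdgeB
  edges-22 : 6 + 2 * b ≡ 2 * (1 + b) + 4
  edges-22 = solve (a ∷ b ∷ [])
  edges-23 : (4 * (2 + a) + 4 * (1 + b)) ∸ 4 ≡ 8 + 4 * a + 4 * b
  edges-23 = ∸-exact split
    where
    split : 4 * (2 + a) + 4 * (1 + b) ≡ 8 + 4 * a + 4 * b + 4
    split = solve (a ∷ b ∷ [])
  edges-33 : (6 * (2 + a) * (1 + b) + (2 + a)) ∸ (5 * (1 + b) + 4) ≡ 5 + 7 * a + 7 * b + 6 * a * b
  edges-33 = ∸-exact split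
    where
    split : 6 * (2 + a) * (1 + b) + (2 + a) ≡ 5 + 7 * a + 7 * b + 6 * a * b + (5 * (1 + b) + 4)
    split = solve (a ∷ b ∷ [])
edge-formula {zero}        ()        _  _ _
edge-formula {suc zero}    (s≤s ())  _  _ _
edge-formula {suc (suc a)} {zero}  _ () _ _

powers-of-squares : ∀ p q r i j k → (p ^ 2) ^ i * (q ^ 2) ^ j * (r ^ 2) ^ k ≡ p ^ (2 * i) * q ^ (2 * j) * r ^ (2 * k)
powers-of-squares p q r i j k rewrite ^-*-assoc p 2 i | ^-*-assoc q 2 j | ^-*-assoc r 2 k = refl

corollary3p2 : (m n : ℕ) → 2 ≤ m → 1 ≤ n →
    let G = B m n
        d = deg G
    in (∏V G (λ u → d u ^ 2) ≡ 4 ^ (2 * m + 4 * n + 2) * 9 ^ ((4 * m * n + 2 * m) ∸ (2 * n + 4)))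
     × (∏E G (λ u v → d u * d v) ≡ 4 ^ (2 * n + 4) * 6 ^ ((4 * m + 4 * n) ∸ 4) * 9 ^ ((6 * m * n + m) ∸ (5 * n + 4)))
     × (∏V G (λ v → d v) ≡ 2 ^ (2 * m + 4 * n + 2) * 3 ^ ((4 * m * n + 2 * m) ∸ (2 * n + 4)))
     × (∏E G (λ u v → d u + d v) ≡ 4 ^ (2 * n + 4) * 5 ^ ((4 * m + 4 * n) ∸ 4) * 6 ^ ((6 * m * n + m) ∸ (5 * n + 4)))
     × (∏E G (λ u v → (d u + d v) ^ 2) ≡ 4 ^ (2 * (2 * n + 4)) * 5 ^ (2 * ((4 * m + 4 * n) ∸ 4)) * 6 ^ (2 * ((6 * m * n + m) ∸ (5 * n + 4))))
     × (∏E G (λ u v → (d u * d v) ^ 2) ≡ 4 ^ (2 * (2 * n + 4)) * 6 ^ (2 * ((4 * m + 4 * n) ∸ 4)) * 9 ^ (2 * ((6 * m * n + m) ∸ (5 * n + 4))))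
corollary3p2 m n 2≤m 1≤n =
  vertex-formula 2≤m 1≤n (_^ 2) ,
  edge-formula 2≤m 1≤n _*_ refl ,
  vertex-formula 2≤m 1≤n id ,
  edge-formula 2≤m 1≤n _+_ refl ,
  trans (edge-formula 2≤m 1≤n (λ x y → (x + y) ^ 2) refl) (powers-of-squares 4 5 6 e₂₂ e₂₃ e₃₃) ,
  trans (edge-formula 2≤m 1≤n (λ x y → (x * y) ^ 2) refl) (powers-of-squares 4 6 9 e₂₂ e₂₃ e₃₃)
  where
  e₂₂ e₂₃ e₃₃ : ℕ
  e₂₂ = 2 * n + 4
  e₂₃ = (4 * m + 4 * n) ∸ 4
  e₃₃ = (6 * m * n + m) ∸ (5 * n + 4)
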